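{- Let $r\ge1$, regard $a_1,\dots,a_r$ as indeterminates, and let $f(x)=(x+a_1)\cdots(x+a_r)$. For all $n,j\in\mathbb{N}$ and all $\beta_1,\dots,\beta_r\in\mathbb{N}$, the coefficient of $a_1^{\beta_1}\cdots a_r^{\beta_r}$ in the polynomial $E_{j,n}^f=e_{n-j}(f(1),\dots,f(n-1))$ equals the number of $r$-Stirling $r$-tuples of permutations $\pi=(\pi_1,\dots,\pi_r)$ of order $(n,j)$ such that $\operatorname{rec}(\pi_i)=\beta_i+1$ for all $i=1,\dots,r$.
   Context: $e_m(x_1,\dots,x_{n-1})$ is the elementary symmetric polynomial of degree $m$ (with $e_0=1$, and $e_m=0$ if $m<0$ or $m$ exceeds the number of variables). An $r$-tuple $\pi=(\pi_1,\dots,\pi_r)\in S_{n+1}^r$ is $r$-Stirling of order $(n,j)$ if (a') each $\pi_i$ has exactly $j+1$ cycles; (b') $\pi_1,\dots,\pi_r$ have the same set of cycle minima (minimum elements of cycles); (c') if $n\ne0$, then $1$ and $2$ lie in different cycles of every $\pi_i$. For a word $w=w(1)\cdots w(l)$, a letter $w(p)$ is a record if $w(k)>w(p)$ for all $k<p$; $\operatorname{rec}(w)$ is the number of records. For $\sigma\in S_{n+1}$, $\operatorname{rec}(\sigma)=\operatorname{rec}(\sigma(1),\sigma^2(1),\dots,1)$, the word listing the orbit of $1$ starting at $\sigma(1)$ and ending at $1$. -}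

module Defs where

open import Data.Nat using (ℕ; zero; suc; _+_; _*_; _∸_; _≤_; _≤?_)
import Data.Nat as ℕ
open import Data.Nat.Properties using () renaming (_≟_ to _≟ℕ_)
open import Data.Fin as Fin using (Fin; toℕ) renaming (zero to fz; suc to fs)
open import Data.Fin.Properties using (all?; any?) renaming (_≟_ to _≟F_; _<?_ to _<?F_; _≤?_ to _≤?F_)
open import Data.List as List using (List; []; _∷_; _++_; length; filter; upTo; concatMap; foldr; map; allFin; [_])
open import Data.Nat.ListAction using (sum)
open import Data.List.Relation.Unary.All as All using (All)
open import Data.Vec as Vec using (Vec; lookup; replicate; _[_]≔_; zipWith)
import Data.Vec.Properties as VecP
open import Data.Product using (Σ; ∃; _×_; _,_)
open import Data.Unit using (⊤; tt)
open import Relation.Binary.PropositionalEquality using (_≡_)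
open import Relation.Nullary using (Dec; yes; no; ¬_; does)
open import Relation.Nullary.Decidable using (_×-dec_; _→-dec_; ¬?)
open import Data.Bool using (if_then_else_)

-- Polynomials in r indeterminates a_1,…,a_r with coefficients in ℕ,
-- represented by their coefficient function: an exponent vector
-- β = (β_1,…,β_r) ↦ coefficient of a_1^β_1 ⋯ a_r^β_r.

Poly : ℕ → Set
Poly r = Vec ℕ r → ℕ

box : ∀ {r} → Vec ℕ r → List (Vec ℕ r)
box Vec.[] = [ Vec.[] ]
box (b Vec.∷ bs) = concatMap (λ g → map (g Vec.∷_) (box bs)) (upTo (suc b))

_⊕_ : ∀ {r} → Poly r → Poly r → Poly r
(P ⊕ Q) β = P β + Q β

_⊛_ : ∀ {r} → Poly r → Poly r → Poly r
(P ⊛ Q) β = sum (map (λ γ → P γ * Q (zipWith _∸_ β γ)) (box β))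

const : ∀ {r} → ℕ → Poly r
const {r} c β = if does (VecP.≡-dec _≟ℕ_ β (replicate r 0)) then c else 0

var : ∀ {r} → Fin r → Poly r
var {r} i β = if does (VecP.≡-dec _≟ℕ_ β (replicate r 0 [ i ]≔ 1)) then 1 else 0

zeroP : ∀ {r} → Poly r
zeroP _ = 0

fpoly : ∀ r → ℕ → Poly r
fpoly r x = foldr (λ i P → (const x ⊕ var i) ⊛ P) (const 1) (allFin r)

esym : ∀ {r} → ℕ → List (Poly r) → Poly r
esym zero _ = const 1
esym (suc m) [] = zeroP
esym (suc m) (p ∷ ps) = esym (suc m) ps ⊕ (p ⊛ esym m ps)

-- E^f_{j,n} = e_{n-j}(f(1),…,f(n-1)), with e_{n-j} = 0 when n - j < 0
Ef : ∀ r → (j n : ℕ) → Poly r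
Ef r j n with j ≤? n
... | yes _ = esym (n ∸ j) (map (λ k → fpoly r (suc k)) (upTo (n ∸ 1)))
... | no _  = zeroP

-- Permutations of an m-element set {1,…,m}, realised as Fin m
-- (Fin.zero ↔ 1, Fin.suc Fin.zero ↔ 2, …), represented as vectors
-- of images σ = (σ(1),…,σ(m)).

Fun : ℕ → Set
Fun m = Vec (Fin m) m

IsPerm : ∀ {m} → Fun m → Set
IsPerm σ = ∀ i j → lookup σ i ≡ lookup σ j → i ≡ j

iter : ∀ {m} → Fun m → ℕ → Fin m → Fin m
iter σ zero i = i
iter σ (suc k) i = lookup σ (iter σ k i)

InCycle : ∀ {m} → Fun m → Fin m → Fin m → Set
InCycle {m} σ i j = ∃ λ (k : Fin m) → iter σ (toℕ k) i ≡ j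

IsCycleMin : ∀ {m} → Fun m → Fin m → Set
IsCycleMin {m} σ i = ∀ j → InCycle σ i j → i Fin.≤ j

isPerm? : ∀ {m} (σ : Fun m) → Dec (IsPerm σ)
isPerm? σ = all? λ i → all? λ j → (lookup σ i ≟F lookup σ j) →-dec (i ≟F j)

inCycle? : ∀ {m} (σ : Fun m) i j → Dec (InCycle σ i j)
inCycle? σ i j = any? λ k → iter σ (toℕ k) i ≟F j

isCycleMin? : ∀ {m} (σ : Fun m) i → Dec (IsCycleMin σ i)
isCycleMin? σ i = all? λ j → inCycle? σ i j →-dec (i ≤?F j)

-- number of cycles = number of cycle minima
cycles : ∀ {m} → Fun m → ℕ
cycles {m} σ = length (filter (isCycleMin? σ) (allFin m))

-- word (σ(1), σ²(1), …, 1): the orbit of 1 starting at σ(1), cut after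
-- the first occurrence of 1
untilOne : ∀ {m} → List (Fin (suc m)) → List (Fin (suc m))
untilOne [] = []
untilOne (fz ∷ xs) = fz ∷ []
untilOne (fs x ∷ xs) = fs x ∷ untilOne xs

orbitWord : ∀ {n} → Fun (suc n) → List (Fin (suc n))
orbitWord {n} σ = untilOne (map (λ k → iter σ (suc k) fz) (upTo (suc n)))

-- number of records of a word: w(p) is a record if w(k) > w(p) for all k < p
recAux : ∀ {m} → List (Fin m) → List (Fin m) → ℕ
recAux prev [] = 0
recAux prev (x ∷ xs) =
  (if does (All.all? (λ y → x <?F y) prev) then 1 else 0) + recAux (prev ++ [ x ]) xs

recW : ∀ {m} → List (Fin m) → ℕ
recW w = recAux [] w

rec : ∀ {n} → Fun (suc n) → ℕ
rec σ = recW (orbitWord σ)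

-- r-Stirling r-tuples of order (n, j): tuples of permutations of
-- {1,…,n+1}

Sep : ∀ n → Fun (suc n) → Set
Sep zero σ = ⊤
Sep (suc n) σ = ¬ InCycle σ fz (fs fz)

sep? : ∀ n (σ : Fun (suc n)) → Dec (Sep n σ)
sep? zero σ = yes tt
sep? (suc n) σ = ¬? (inCycle? σ fz (fs fz))

IsRStirling : ∀ {r} (n j : ℕ) → Vec (Fun (suc n)) r → Set
IsRStirling n j π =
  (∀ p → IsPerm (lookup π p)) ×
  (∀ p → cycles (lookup π p) ≡ suc j) ×
  (∀ p q i → IsCycleMin (lookup π p) i → IsCycleMin (lookup π q) i) ×
  (∀ p → Sep n (lookup π p))

isRStirling? : ∀ {r} n j (π : Vec (Fun (suc n)) r) → Dec (IsRStirling n j π)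
isRStirling? n j π =
  (all? λ p → isPerm? (lookup π p)) ×-dec
  (all? λ p → cycles (lookup π p) ≟ℕ suc j) ×-dec
  (all? λ p → all? λ q → all? λ i →
     isCycleMin? (lookup π p) i →-dec isCycleMin? (lookup π q) i) ×-dec
  (all? λ p → sep? n (lookup π p))

Counted : ∀ {r} (n j : ℕ) (β : Vec ℕ r) → Vec (Fun (suc n)) r → Set
Counted n j β π = IsRStirling n j π × (∀ p → rec (lookup π p) ≡ suc (lookup β p))

counted? : ∀ {r} n j β (π : Vec (Fun (suc n)) r) → Dec (Counted n j β π)
counted? n j β π = isRStirling? n j π ×-dec (all? λ p → rec (lookup π p) ≟ℕ suc (lookup β p))

allVecs : ∀ {A : Set} → List A → ∀ k → List (Vec A k)
allVecs xs zero = [ Vec.[] ]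
allVecs xs (suc k) = concatMap (λ x → map (x Vec.∷_) (allVecs xs k)) xs

allFuns : ∀ m → List (Fun m)
allFuns m = allVecs (allFin m) m

countTuples : ∀ r (n j : ℕ) (β : Vec ℕ r) → ℕ
countTuples r n j β = length (filter (counted? n j β) (allVecs (allFuns (suc n)) r))

-- Both sides satisfy the same recurrence in n, starting from n = 2.
--
-- Multiplying by f(x) = (x + a₁)⋯(x + a_r) acts on coefficients by an explicit
-- recurrence in the exponent of a₁; these operators commute, and peeling off
-- the last value f(n) gives E_{j,n+1} = E_{j-1,n} + f(n)·E_{j,n} for n ≥ 1.
--
-- A counted tuple is determined by its common set M of cycle minima, with |M| = j + 1,
-- together with, independently for each i, a permutation with minima M satisfying (c')
-- and having β_i + 1 records. Deleting the maximal element n + 1 from such a permutation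
-- is a bijection onto pairs (σ, o), where o records whether n + 1 was a fixed point (then
-- it is a cycle minimum) or which element it followed; it is an extra record exactly when
-- it followed 1. So if n + 1 is not a minimum, the count is n·c(β) + c(β - 1), which is
-- the coefficient recurrence of multiplication by f(n); if it is, the count is unchanged
-- and |M| drops by one, giving the E_{j-1,n} term.

module Submission where

open import Defs
open import Data.Bool using (Bool; true; false; if_then_else_)
open import Data.Bool.Properties using () renaming (_≟_ to _≟B_)
open import Data.Empty using (⊥; ⊥-elim)
open import Data.Fin as Fin using (Fin; toℕ; fromℕ; inject₁) renaming (zero to fz; suc to fs)
import Data.Fin.Properties as Finₚ
open import Data.Fin.Properties
  using (pigeonhole; any?; all?; toℕ-fromℕ<; toℕ<n; toℕ-fromℕ; toℕ-inject₁; fromℕ≢inject₁; inject₁-injective)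
  renaming (_≟_ to _≟F_; _<?_ to _<?F_)
open import Data.Fin.Relation.Unary.Top using (View; ‵fromℕ; ‵inject₁; view; view-fromℕ; view-inject₁)
open import Data.List as List
  using (List; []; _∷_; _++_; length; upTo; applyUpTo; map; concatMap; foldr; filter; [_])
import Data.List.Properties as Listₚ
open import Data.List.Relation.Unary.All as All using (All; []; _∷_)
import Data.List.Relation.Unary.All.Properties as Allₚ
open import Data.Maybe as Maybe using (Maybe; just; nothing; is-nothing)
import Data.Maybe.Properties as Maybeₚ
open import Data.Nat using (ℕ; zero; suc; _+_; _*_; _∸_; _≤_; _<_; _≤?_; _≟_; z≤n; s≤s)
open import Data.Nat.DivMod using (_%_; _/_; m≡m%n+[m/n]*n; m%n<n)
open import Data.Nat.ListAction using (sum)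
open import Data.Nat.Properties
open import Data.Nat.Tactic.RingSolver using (solve-∀)
open import Data.Product using (∃; _×_; _,_; proj₁; proj₂)
import Data.Product.Properties as Productₚ
open import Data.Sum using (_⊎_; inj₁; inj₂)
open import Data.Unit using (⊤; tt)
open import Data.Vec as Vec using (Vec; _∷_; []; lookup; _∷ʳ_)
import Data.Vec.Properties as Vecₚ
open import Function using (_∘′_; case_of_)
open import Function.Bundles using (_⇔_; mk⇔; module Equivalence)
open import Relation.Binary using (DecidableEquality; tri<; tri≈; tri>)
open import Relation.Binary.PropositionalEquality hiding ([_])
open import Relation.Nullary using (Dec; yes; no; ¬_; does)
open import Relation.Nullary.Decidable
  using (dec-true; dec-false; does-⇔; ¬?; dec⇒maybe; _×-dec_; decidable-stable)
open import Relation.Unary using (Decidable)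

∑ : {A : Set} → (A → ℕ) → List A → ℕ
∑ f xs = sum (map f xs)

∑< : ℕ → (ℕ → ℕ) → ℕ
∑< n f = sum (applyUpTo f n)

∑-cong : {A : Set} {f g : A → ℕ} (xs : List A) → (∀ x → f x ≡ g x) → ∑ f xs ≡ ∑ g xs
∑-cong []       f≗g = refl
∑-cong (x ∷ xs) f≗g = cong₂ _+_ (f≗g x) (∑-cong xs f≗g)

∑-zero : {A : Set} {f : A → ℕ} (xs : List A) → (∀ x → f x ≡ 0) → ∑ f xs ≡ 0
∑-zero []       f≗0 = refl
∑-zero (x ∷ xs) f≗0 = cong₂ _+_ (f≗0 x) (∑-zero xs f≗0)

∑<-zero : ∀ n {f : ℕ → ℕ} → (∀ g → f g ≡ 0) → ∑< n f ≡ 0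
∑<-zero zero    f≗0 = refl
∑<-zero (suc n) f≗0 = cong₂ _+_ (f≗0 0) (∑<-zero n (λ g → f≗0 (suc g)))

∑-+ : {A : Set} (f g : A → ℕ) (xs : List A) → ∑ (λ x → f x + g x) xs ≡ ∑ f xs + ∑ g xs
∑-+ f g []       = refl
∑-+ f g (x ∷ xs) rewrite ∑-+ f g xs = +-interchange (f x) (g x) _ _
  where
  +-interchange : ∀ a b c d → a + b + (c + d) ≡ a + c + (b + d)
  +-interchange = solve-∀

∑-*ˡ : {A : Set} (c : ℕ) (f : A → ℕ) (xs : List A) → ∑ (λ x → c * f x) xs ≡ c * ∑ f xs
∑-*ˡ c f []       = sym (*-zeroʳ c)
∑-*ˡ c f (x ∷ xs) rewrite ∑-*ˡ c f xs = sym (*-distribˡ-+ c (f x) _)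

∑-const : {A : Set} (c : ℕ) (xs : List A) → ∑ (λ _ → c) xs ≡ length xs * c
∑-const c []       = refl
∑-const c (_ ∷ xs) = cong (c +_) (∑-const c xs)

∑-++ : {A : Set} (f : A → ℕ) (xs ys : List A) → ∑ f (xs ++ ys) ≡ ∑ f xs + ∑ f ys
∑-++ f []       ys = refl
∑-++ f (x ∷ xs) ys rewrite ∑-++ f xs ys = sym (+-assoc (f x) _ _)

∑-map : {A B : Set} (f : B → ℕ) (g : A → B) (xs : List A) → ∑ f (map g xs) ≡ ∑ (λ x → f (g x)) xs
∑-map f g []       = refl
∑-map f g (x ∷ xs) = cong (f (g x) +_) (∑-map f g xs)

∑-concatMap : {A B : Set} (f : B → ℕ) (g : A → List B) (xs : List A) →
  ∑ f (concatMap g xs) ≡ ∑ (λ x → ∑ f (g x)) xs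
∑-concatMap f g []       = refl
∑-concatMap f g (x ∷ xs) = trans (∑-++ f (g x) (concatMap g xs)) (cong (∑ f (g x) +_) (∑-concatMap f g xs))

∑-comm : {A B : Set} (f : A → B → ℕ) (xs : List A) (ys : List B) →
  ∑ (λ x → ∑ (f x) ys) xs ≡ ∑ (λ y → ∑ (λ x → f x y) xs) ys
∑-comm f []       ys = sym (∑-zero ys (λ _ → refl))
∑-comm f (x ∷ xs) ys rewrite ∑-comm f xs ys = sym (∑-+ (f x) (λ y → ∑ (λ x → f x y) xs) ys)

indicator : {P : Set} → Dec P → ℕ
indicator d = if does d then 1 else 0

indicator-⇔ : {P Q : Set} → P ⇔ Q → (p : Dec P) (q : Dec Q) → indicator p ≡ indicator q
indicator-⇔ P⇔Q p q = cong (λ b → if b then 1 else 0) (does-⇔ P⇔Q p q)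

indicator-yes : {P : Set} (p : Dec P) → P → indicator p ≡ 1
indicator-yes p P = cong (λ b → if b then 1 else 0) (dec-true p P)

indicator-no : {P : Set} (p : Dec P) → ¬ P → indicator p ≡ 0
indicator-no p ¬P = cong (λ b → if b then 1 else 0) (dec-false p ¬P)

infix 4 _≈_
_≈_ : ∀ {r} → Poly r → Poly r → Set
P ≈ Q = ∀ β → P β ≡ Q β

slice : ∀ {r} → Poly (suc r) → ℕ → Poly r
slice P g γ = P (g ∷ γ)

⊛-∷ : ∀ {r} (P Q : Poly (suc r)) b β →
  (P ⊛ Q) (b ∷ β) ≡ ∑< (suc b) (λ g → (slice P g ⊛ slice Q (b ∸ g)) β)
⊛-∷ P Q b β = begin
  ∑ _ (concatMap (λ g → map (g ∷_) (box β)) (upTo (suc b)))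
    ≡⟨ ∑-concatMap _ (λ g → map (g ∷_) (box β)) (upTo (suc b)) ⟩
  ∑ (λ g → ∑ _ (map (g ∷_) (box β))) (upTo (suc b))
    ≡⟨ ∑-cong (upTo (suc b)) (λ g → ∑-map _ (g ∷_) (box β)) ⟩
  ∑ (λ g → (slice P g ⊛ slice Q (b ∸ g)) β) (upTo (suc b))
    ≡⟨ cong sum (Listₚ.map-upTo _ (suc b)) ⟩
  ∑< (suc b) (λ g → (slice P g ⊛ slice Q (b ∸ g)) β) ∎
  where open ≡-Reasoning

⊛-congˡ : ∀ {r} {P P′ : Poly r} (Q : Poly r) → P ≈ P′ → (P ⊛ Q) ≈ (P′ ⊛ Q)
⊛-congˡ Q P≈P′ β = ∑-cong (box β) (λ γ → cong (_* _) (P≈P′ γ))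

⊛-congʳ : ∀ {r} (P : Poly r) {Q Q′ : Poly r} → Q ≈ Q′ → (P ⊛ Q) ≈ (P ⊛ Q′)
⊛-congʳ P Q≈Q′ β = ∑-cong (box β) (λ γ → cong (P γ *_) (Q≈Q′ _))

*-⊛ : ∀ {r} (c : ℕ) (P Q : Poly r) → ((λ γ → c * P γ) ⊛ Q) ≈ (λ β → c * (P ⊛ Q) β)
*-⊛ c P Q β = trans (∑-cong (box β) (λ γ → *-assoc c (P γ) _)) (∑-*ˡ c _ (box β))

⊛-zeroˡ : ∀ {r} {P : Poly r} (Q : Poly r) → P ≈ zeroP → (P ⊛ Q) ≈ zeroP
⊛-zeroˡ Q P≈0 β = ∑-zero (box β) (λ γ → cong (_* _) (P≈0 γ))

⊛-zeroʳ : ∀ {r} (P : Poly r) {Q : Poly r} → Q ≈ zeroP → (P ⊛ Q) ≈ zeroP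
⊛-zeroʳ P Q≈0 β = ∑-zero (box β) (λ γ → trans (cong (P γ *_) (Q≈0 _)) (*-zeroʳ (P γ)))

⊛-identityˡ : ∀ {r} (Q : Poly r) → (const 1 ⊛ Q) ≈ Q
⊛-identityˡ {zero}  Q []      = trans (+-identityʳ _) (*-identityˡ _)
⊛-identityˡ {suc r} Q (b ∷ β) = begin
  (const 1 ⊛ Q) (b ∷ β)
    ≡⟨ ⊛-∷ (const 1) Q b β ⟩
  (const 1 ⊛ slice Q b) β + ∑< b higher
    ≡⟨ cong₂ _+_ (⊛-identityˡ (slice Q b) β) (∑<-zero b higher≡0) ⟩
  Q (b ∷ β) + 0
    ≡⟨ +-identityʳ _ ⟩
  Q (b ∷ β) ∎
  where
  open ≡-Reasoning
  higher : ℕ → ℕ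
  higher g = (slice (const 1) (suc g) ⊛ slice Q (b ∸ suc g)) β
  higher≡0 : ∀ g → higher g ≡ 0
  higher≡0 g = ⊛-zeroˡ {P = slice (const 1) (suc g)} (slice Q (b ∸ suc g)) (λ _ → refl) β

const-* : ∀ {r} c → const {r} c ≈ (λ γ → c * const 1 γ)
const-* c γ = if-* _
  where
  if-* : ∀ b → (if b then c else 0) ≡ c * (if b then 1 else 0)
  if-* true  = sym (*-identityʳ c)
  if-* false = sym (*-zeroʳ c)

⊛-∷-zero : ∀ {r} (P Q : Poly (suc r)) β → (P ⊛ Q) (0 ∷ β) ≡ (slice P 0 ⊛ slice Q 0) β
⊛-∷-zero P Q β = trans (⊛-∷ P Q 0 β) (+-identityʳ _)

AffineIn₁ : ∀ {r} → Poly (suc r) → Set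
AffineIn₁ P = ∀ g → slice P (suc (suc g)) ≈ zeroP

⊛-∷-suc : ∀ {r} (P : Poly (suc r)) → AffineIn₁ P → ∀ Q b β →
  (P ⊛ Q) (suc b ∷ β) ≡ (slice P 0 ⊛ slice Q (suc b)) β + (slice P 1 ⊛ slice Q b) β
⊛-∷-suc P affine Q b β = begin
  (P ⊛ Q) (suc b ∷ β)                   ≡⟨ ⊛-∷ P Q (suc b) β ⟩
  t₀ + (t₁ + ∑< b higher)               ≡⟨ cong (λ s → t₀ + (t₁ + s)) (∑<-zero b higher≡0) ⟩
  t₀ + (t₁ + 0)                         ≡⟨ cong (t₀ +_) (+-identityʳ t₁) ⟩
  t₀ + t₁                               ∎
  where
  open ≡-Reasoning
  t₀ = (slice P 0 ⊛ slice Q (suc b)) β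
  t₁ = (slice P 1 ⊛ slice Q b) β
  higher : ℕ → ℕ
  higher g = (slice P (suc (suc g)) ⊛ slice Q (b ∸ suc g)) β
  higher≡0 : ∀ g → higher g ≡ 0
  higher≡0 g = ⊛-zeroˡ (slice Q (b ∸ suc g)) (affine g) β

linearCoeff : ℕ → ℕ → ℕ
linearCoeff x zero          = x
linearCoeff x (suc zero)    = 1
linearCoeff x (suc (suc _)) = 0

fCoeff : ∀ {r} → ℕ → Poly r
fCoeff x []      = 1
fCoeff x (g ∷ γ) = linearCoeff x g * fCoeff x γ

linearProduct : ∀ {r} → ℕ → List (Fin r) → Poly r
linearProduct x = foldr (λ i P → (const x ⊕ var i) ⊛ P) (const 1)

linearProduct-slice-zero : ∀ {r} x (I : List (Fin r)) → slice (linearProduct x (map fs I)) 0 ≈ linearProduct x I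
linearProduct-slice-zero x []      γ = refl
linearProduct-slice-zero x (i ∷ I) γ =
  trans (⊛-∷-zero (const x ⊕ var (fs i)) (linearProduct x (map fs I)) γ)
        (⊛-congʳ (const x ⊕ var i) (linearProduct-slice-zero x I) γ)

linearProduct-slice-suc : ∀ {r} x (I : List (Fin r)) g → slice (linearProduct x (map fs I)) (suc g) ≈ zeroP
linearProduct-slice-suc x []      g γ = refl
linearProduct-slice-suc x (i ∷ I) g γ = begin
  ((const x ⊕ var (fs i)) ⊛ P) (suc g ∷ γ)
    ≡⟨ ⊛-∷-suc (const x ⊕ var (fs i)) (λ _ _ → refl) P g γ ⟩
  ((const x ⊕ var i) ⊛ slice P (suc g)) γ + (zeroP ⊛ slice P g) γ
    ≡⟨ cong₂ _+_ (⊛-zeroʳ (const x ⊕ var i) (linearProduct-slice-suc x I g) γ)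
        (⊛-zeroˡ (slice P g) (λ _ → refl) γ) ⟩
  0 ∎
  where
  open ≡-Reasoning
  P = linearProduct x (map fs I)

fpoly-coeff : ∀ r x → fpoly r x ≈ fCoeff x
fpoly-coeff zero    x []      = refl
fpoly-coeff (suc r) x (g ∷ γ) =
  trans (cong (λ I → linearProduct x (fz ∷ I) (g ∷ γ)) (sym (Listₚ.map-tabulate (λ i → i) fs))) (coeff g)
  where
  open ≡-Reasoning
  P = linearProduct x (map fs (List.allFin r))
  P₀≈f : slice P 0 ≈ fCoeff x
  P₀≈f γ = trans (linearProduct-slice-zero x (List.allFin r) γ) (fpoly-coeff r x γ)
  Pₛ≈0 : ∀ g → slice P (suc g) ≈ zeroP
  Pₛ≈0 = linearProduct-slice-suc x (List.allFin r)
  coeff : ∀ g → ((const x ⊕ var fz) ⊛ P) (g ∷ γ) ≡ fCoeff x (g ∷ γ)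
  coeff zero = begin
    ((const x ⊕ var fz) ⊛ P) (0 ∷ γ)
      ≡⟨ ⊛-∷-zero (const x ⊕ var fz) P γ ⟩
    (slice (const x ⊕ var fz) 0 ⊛ slice P 0) γ
      ≡⟨ ⊛-congˡ (slice P 0) (λ β → trans (+-identityʳ _) (const-* x β)) γ ⟩
    ((λ β → x * const 1 β) ⊛ slice P 0) γ
      ≡⟨ *-⊛ x (const 1) (slice P 0) γ ⟩
    x * (const 1 ⊛ slice P 0) γ
      ≡⟨ cong (x *_) (trans (⊛-identityˡ (slice P 0) γ) (P₀≈f γ)) ⟩
    x * fCoeff x γ ∎
  coeff (suc b) = begin
    ((const x ⊕ var fz) ⊛ P) (suc b ∷ γ)
      ≡⟨ ⊛-∷-suc (const x ⊕ var fz) (λ _ _ → refl) P b γ ⟩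
    (slice (const x ⊕ var fz) 0 ⊛ slice P (suc b)) γ + (const 1 ⊛ slice P b) γ
      ≡⟨ cong₂ _+_ (⊛-zeroʳ (slice (const x ⊕ var fz) 0) (Pₛ≈0 b) γ) (⊛-identityˡ (slice P b) γ) ⟩
    slice P b γ
      ≡⟨ top b ⟩
    fCoeff x (suc b ∷ γ) ∎
    where
    top : ∀ b → slice P b γ ≡ fCoeff x (suc b ∷ γ)
    top zero    = trans (P₀≈f γ) (sym (+-identityʳ _))
    top (suc b) = Pₛ≈0 b γ

-- Multiplication by f(x) as a recurrence on the coefficients in a₁. Unlike ⊛, these
-- operators visibly commute, which is all that elementary symmetric functions need.
mulF : ∀ {r} → ℕ → Poly r → Poly r
mulF {zero}  x Q []          = Q []
mulF {suc r} x Q (zero  ∷ β) = x * mulF x (slice Q 0) β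
mulF {suc r} x Q (suc b ∷ β) = x * mulF x (slice Q (suc b)) β + mulF x (slice Q b) β

fCoeff-⊛ : ∀ {r} x (Q : Poly r) → (fCoeff x ⊛ Q) ≈ mulF x Q
fCoeff-⊛ {zero}  x Q []      = trans (+-identityʳ _) (+-identityʳ _)
fCoeff-⊛ {suc r} x Q (b ∷ β) = coeff b
  where
  scaled : ∀ c b → ((λ γ → c * fCoeff x γ) ⊛ slice Q b) β ≡ c * mulF x (slice Q b) β
  scaled c b = trans (*-⊛ c (fCoeff x) (slice Q b) β) (cong (c *_) (fCoeff-⊛ x (slice Q b) β))
  coeff : ∀ b → (fCoeff x ⊛ Q) (b ∷ β) ≡ mulF x Q (b ∷ β)
  coeff zero    = trans (⊛-∷-zero (fCoeff x) Q β) (scaled x 0)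
  coeff (suc b) =
    trans (⊛-∷-suc (fCoeff x) (λ _ _ → refl) Q b β)
          (cong₂ _+_ (scaled x (suc b)) (trans (scaled 1 b) (*-identityˡ _)))

fpoly-⊛ : ∀ r x (Q : Poly r) → (fpoly r x ⊛ Q) ≈ mulF x Q
fpoly-⊛ r x Q β = trans (⊛-congˡ Q (fpoly-coeff r x) β) (fCoeff-⊛ x Q β)

mulF-cong : ∀ {r} x {P Q : Poly r} → P ≈ Q → mulF x P ≈ mulF x Q
mulF-cong {zero}  x P≈Q []          = P≈Q []
mulF-cong {suc r} x P≈Q (zero  ∷ β) = cong (x *_) (mulF-cong x (λ _ → P≈Q _) β)
mulF-cong {suc r} x P≈Q (suc b ∷ β) =
  cong₂ _+_ (cong (x *_) (mulF-cong x (λ _ → P≈Q _) β)) (mulF-cong x (λ _ → P≈Q _) β)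

mulF-⊕ : ∀ {r} x (P Q : Poly r) → mulF x (P ⊕ Q) ≈ (mulF x P ⊕ mulF x Q)
mulF-⊕ {zero}  x P Q [] = refl
mulF-⊕ {suc r} x P Q (zero ∷ β) rewrite mulF-⊕ x (slice P 0) (slice Q 0) β = *-distribˡ-+ x _ _
mulF-⊕ {suc r} x P Q (suc b ∷ β)
  rewrite mulF-⊕ x (slice P (suc b)) (slice Q (suc b)) β | mulF-⊕ x (slice P b) (slice Q b) β = distrib x _ _ _ _
  where
  distrib : ∀ x a b c d → x * (a + b) + (c + d) ≡ (x * a + c) + (x * b + d)
  distrib = solve-∀

mulF-* : ∀ {r} x c (P : Poly r) → mulF x (λ γ → c * P γ) ≈ (λ γ → c * mulF x P γ)
mulF-* {zero}  x c P [] = refl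
mulF-* {suc r} x c P (zero ∷ β) rewrite mulF-* x c (slice P 0) β = swap x c _
  where
  swap : ∀ x c a → x * (c * a) ≡ c * (x * a)
  swap = solve-∀
mulF-* {suc r} x c P (suc b ∷ β)
  rewrite mulF-* x c (slice P (suc b)) β | mulF-* x c (slice P b) β = distrib x c _ _
  where
  distrib : ∀ x c a d → x * (c * a) + c * d ≡ c * (x * a + d)
  distrib = solve-∀

mulF-zero : ∀ {r} x → mulF {r} x zeroP ≈ zeroP
mulF-zero {zero}  x [] = refl
mulF-zero {suc r} x (zero  ∷ β) rewrite mulF-zero {r} x β = *-zeroʳ x
mulF-zero {suc r} x (suc b ∷ β) rewrite mulF-zero {r} x β = cong (_+ 0) (*-zeroʳ x)

mulF-slice-zero : ∀ {r} x y (P : Poly (suc r)) β →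
  mulF x (slice (mulF y P) 0) β ≡ y * mulF x (mulF y (slice P 0)) β
mulF-slice-zero x y P β = mulF-* x y (mulF y (slice P 0)) β

mulF-slice-suc : ∀ {r} x y (P : Poly (suc r)) b β →
  mulF x (slice (mulF y P) (suc b)) β ≡ y * mulF x (mulF y (slice P (suc b))) β + mulF x (mulF y (slice P b)) β
mulF-slice-suc x y P b β =
  trans (mulF-⊕ x (λ γ → y * mulF y (slice P (suc b)) γ) (mulF y (slice P b)) β)
        (cong (_+ mulF x (mulF y (slice P b)) β) (mulF-* x y (mulF y (slice P (suc b))) β))

mulF-comm : ∀ {r} x y (P : Poly r) → mulF x (mulF y P) ≈ mulF y (mulF x P)
mulF-comm {zero}  x y P [] = refl
mulF-comm {suc r} x y P (zero ∷ β)
  rewrite mulF-slice-zero x y P β | mulF-slice-zero y x P β | mulF-comm x y (slice P 0) β = swap x y _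
  where
  swap : ∀ x y a → x * (y * a) ≡ y * (x * a)
  swap = solve-∀
mulF-comm {suc r} x y P (suc zero ∷ β)
  rewrite mulF-slice-zero x y P β | mulF-slice-zero y x P β | mulF-slice-suc x y P 0 β | mulF-slice-suc y x P 0 β
        | mulF-comm x y (slice P 0) β | mulF-comm x y (slice P 1) β = shuffle x y _ _
  where
  shuffle : ∀ x y a b → x * (y * a + b) + y * b ≡ y * (x * a + b) + x * b
  shuffle = solve-∀
mulF-comm {suc r} x y P (suc (suc b) ∷ β)
  rewrite mulF-slice-suc x y P b β | mulF-slice-suc y x P b β
        | mulF-slice-suc x y P (suc b) β | mulF-slice-suc y x P (suc b) β
        | mulF-comm x y (slice P b) β | mulF-comm x y (slice P (suc b)) β | mulF-comm x y (slice P (suc (suc b))) β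
        = shuffle x y _ _ _
  where
  shuffle : ∀ x y a b c → x * (y * a + b) + (y * b + c) ≡ y * (x * a + b) + (x * b + c)
  shuffle = solve-∀

-- The recurrence for E^f_{j,n}

esymF : ∀ {r} → ℕ → List ℕ → Poly r
esymF zero    _        = const 1
esymF (suc m) []       = zeroP
esymF (suc m) (x ∷ xs) = esymF (suc m) xs ⊕ mulF x (esymF m xs)

esym-fpoly : ∀ {r} m xs → esym {r} m (map (fpoly r) xs) ≈ esymF m xs
esym-fpoly zero    xs       β = refl
esym-fpoly (suc m) []       β = refl
esym-fpoly {r} (suc m) (x ∷ xs) β =
  cong₂ _+_ (esym-fpoly (suc m) xs β) (trans (⊛-congʳ (fpoly r x) (esym-fpoly m xs) β) (fpoly-⊛ r x _ β))

esymF-∷ʳ : ∀ {r} m xs y → esymF {r} (suc m) (xs ++ [ y ]) ≈ (esymF (suc m) xs ⊕ mulF y (esymF m xs))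
esymF-∷ʳ m       []       y β = refl
esymF-∷ʳ zero    (x ∷ xs) y β rewrite esymF-∷ʳ zero xs y β = swap₂₃ (esymF 1 xs β) _ _
  where
  swap₂₃ : ∀ a b c → a + b + c ≡ a + c + b
  swap₂₃ = solve-∀
esymF-∷ʳ {r} (suc m) (x ∷ xs) y β = begin
  esymF (2 + m) (xs ++ [ y ]) β + mulF x (esymF (suc m) (xs ++ [ y ])) β
    ≡⟨ cong₂ _+_ (esymF-∷ʳ (suc m) xs y β)
                 (trans (mulF-cong x (esymF-∷ʳ m xs y) β) (mulF-⊕ x E₁ (mulF y E₀) β)) ⟩
  E₂ β + mulF y E₁ β + (mulF x E₁ β + mulF x (mulF y E₀) β)
    ≡⟨ cong (λ t → E₂ β + mulF y E₁ β + (mulF x E₁ β + t)) (mulF-comm x y E₀ β) ⟩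
  E₂ β + mulF y E₁ β + (mulF x E₁ β + mulF y (mulF x E₀) β)
    ≡⟨ interchange (E₂ β) (mulF y E₁ β) (mulF x E₁ β) _ ⟩
  E₂ β + mulF x E₁ β + (mulF y E₁ β + mulF y (mulF x E₀) β)
    ≡⟨ cong (E₂ β + mulF x E₁ β +_) (mulF-⊕ y E₁ (mulF x E₀) β) ⟨
  E₂ β + mulF x E₁ β + mulF y (E₁ ⊕ mulF x E₀) β ∎
  where
  open ≡-Reasoning
  E₂ E₁ E₀ : Poly r
  E₂ = esymF (2 + m) xs
  E₁ = esymF (suc m) xs
  E₀ = esymF m xs
  interchange : ∀ a b c d → a + b + (c + d) ≡ a + c + (b + d)
  interchange = solve-∀

esymF-vanish : ∀ {r} m xs → length xs < m → esymF {r} m xs ≈ zeroP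
esymF-vanish (suc m)       []       _              β = refl
esymF-vanish (suc zero)    (x ∷ xs) (s≤s ())
esymF-vanish (suc (suc m)) (x ∷ xs) (s≤s |xs|<1+m) β =
  cong₂ _+_ (esymF-vanish (2 + m) xs (m≤n⇒m≤1+n |xs|<1+m) β)
            (trans (mulF-cong x (esymF-vanish (suc m) xs |xs|<1+m) β) (mulF-zero x β))

points : ℕ → List ℕ
points n = map suc (upTo n)

points-suc : ∀ n → points (suc n) ≡ points n ++ [ suc n ]
points-suc n = trans (cong (map suc) (sym (Listₚ.upTo-∷ʳ n))) (Listₚ.map-++ suc (upTo n) [ n ])

length-points : ∀ n → length (points n) ≡ n
length-points n = trans (Listₚ.length-map suc (upTo n)) (Listₚ.length-upTo n)

Ef-≤ : ∀ r j n → j ≤ n → Ef r j n ≈ esymF (n ∸ j) (points (n ∸ 1))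
Ef-≤ r j n j≤n β with j ≤? n
... | yes _   = trans (cong (λ ps → esym (n ∸ j) ps β) (Listₚ.map-∘ (upTo (n ∸ 1)))) (esym-fpoly (n ∸ j) _ β)
... | no j≰n = ⊥-elim (j≰n j≤n)

Ef-≰ : ∀ r j n → ¬ j ≤ n → Ef r j n ≈ zeroP
Ef-≰ r j n j≰n β with j ≤? n
... | yes j≤n = ⊥-elim (j≰n j≤n)
... | no _    = refl

prevJ : ∀ {r} → (ℕ → ℕ → Poly r) → ℕ → ℕ → Poly r
prevJ F zero    N = zeroP
prevJ F (suc j) N = F j N

module _ (r N : ℕ) where

  private
    N₊ = suc N

  Ef-step-≤ : ∀ j → j ≤ N₊ → Ef r j (suc N₊) ≈ (prevJ (Ef r) j N₊ ⊕ mulF N₊ (Ef r j N₊))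
  Ef-step-≤ j j≤N₊ β = begin
    Ef r j (suc N₊) β
      ≡⟨ Ef-≤ r j (suc N₊) (m≤n⇒m≤1+n j≤N₊) β ⟩
    esymF (suc N₊ ∸ j) (points N₊) β
      ≡⟨ cong₂ (λ k ps → esymF k ps β) (+-∸-assoc 1 j≤N₊) (points-suc N) ⟩
    esymF (suc (N₊ ∸ j)) (points N ++ [ N₊ ]) β
      ≡⟨ esymF-∷ʳ (N₊ ∸ j) (points N) N₊ β ⟩
    esymF (suc (N₊ ∸ j)) (points N) β + mulF N₊ (esymF (N₊ ∸ j) (points N)) β
      ≡⟨ cong₂ _+_ (prev j j≤N₊) (mulF-cong N₊ (λ γ → sym (Ef-≤ r j N₊ j≤N₊ γ)) β) ⟩
    prevJ (Ef r) j N₊ β + mulF N₊ (Ef r j N₊) β ∎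
    where
    open ≡-Reasoning
    prev : ∀ j → j ≤ N₊ → esymF (suc (N₊ ∸ j)) (points N) β ≡ prevJ (Ef r) j N₊ β
    prev zero    _      =
      esymF-vanish (suc N₊) (points N) (subst (_< suc N₊) (sym (length-points N)) (m≤n⇒m≤1+n (n<1+n N))) β
    prev (suc j) 1+j≤N₊ =
      trans (cong (λ k → esymF k (points N) β) (sym (+-∸-assoc 1 1+j≤N₊)))
            (sym (Ef-≤ r j N₊ (<⇒≤ 1+j≤N₊) β))

  Ef-step-diagonal : Ef r (suc N₊) (suc N₊) ≈ (prevJ (Ef r) (suc N₊) N₊ ⊕ mulF N₊ (Ef r (suc N₊) N₊))
  Ef-step-diagonal β = begin
    Ef r (suc N₊) (suc N₊) β
      ≡⟨ Ef-≤ r (suc N₊) (suc N₊) ≤-refl β ⟩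
    esymF (suc N₊ ∸ suc N₊) (points N₊) β
      ≡⟨ cong (λ k → esymF k (points N₊) β) (n∸n≡0 (suc N₊)) ⟩
    const 1 β
      ≡⟨ cong (λ k → esymF k (points N) β) (n∸n≡0 N₊) ⟨
    esymF (N₊ ∸ N₊) (points N) β
      ≡⟨ Ef-≤ r N₊ N₊ ≤-refl β ⟨
    Ef r N₊ N₊ β
      ≡⟨ +-identityʳ _ ⟨
    Ef r N₊ N₊ β + 0
      ≡⟨ cong (Ef r N₊ N₊ β +_) (trans (mulF-cong N₊ (Ef-≰ r (suc N₊) N₊ 1+n≰n) β) (mulF-zero N₊ β)) ⟨
    Ef r N₊ N₊ β + mulF N₊ (Ef r (suc N₊) N₊) β ∎
    where open ≡-Reasoning

  Ef-step-> : ∀ j → suc N₊ < j → Ef r j (suc N₊) ≈ (prevJ (Ef r) j N₊ ⊕ mulF N₊ (Ef r j N₊))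
  Ef-step-> (suc j) (s≤s N₊<j) β = begin
    Ef r (suc j) (suc N₊) β
      ≡⟨ Ef-≰ r (suc j) (suc N₊) (<⇒≱ N₊<j ∘′ ≤-pred) β ⟩
    0 + 0
      ≡⟨ cong₂ _+_ (Ef-≰ r j N₊ (<⇒≱ N₊<j) β)
          (trans (mulF-cong N₊ (Ef-≰ r (suc j) N₊ (<⇒≱ N₊<j ∘′ <⇒≤)) β) (mulF-zero N₊ β)) ⟨
    Ef r j N₊ β + mulF N₊ (Ef r (suc j) N₊) β ∎
    where open ≡-Reasoning

  Ef-step : ∀ j → Ef r j (suc N₊) ≈ (prevJ (Ef r) j N₊ ⊕ mulF N₊ (Ef r j N₊))
  Ef-step j with <-cmp j (suc N₊)
  ... | tri< j<2+N _ _ = Ef-step-≤ j (≤-pred j<2+N)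
  ... | tri≈ _ refl _  = Ef-step-diagonal
  ... | tri> _ _ 2+N<j = Ef-step-> j 2+N<j

iter-sucʳ : ∀ {m} (σ : Fun m) k x → iter σ (suc k) x ≡ iter σ k (lookup σ x)
iter-sucʳ σ zero    x = refl
iter-sucʳ σ (suc k) x = cong (lookup σ) (iter-sucʳ σ k x)

iter-suc⇒ : ∀ {m} (σ : Fun m) k {x y z} → lookup σ x ≡ y → iter σ (suc k) x ≡ z → iter σ k y ≡ z
iter-suc⇒ σ k {x} σx≡y eq = trans (cong (iter σ k) (sym σx≡y)) (trans (sym (iter-sucʳ σ k x)) eq)

iter-+ : ∀ {m} (σ : Fun m) a b x → iter σ (a + b) x ≡ iter σ a (iter σ b x)
iter-+ σ zero    b x = refl
iter-+ σ (suc a) b x = cong (lookup σ) (iter-+ σ a b x)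

iter-injective : ∀ {m} (σ : Fun m) → IsPerm σ → ∀ a {x y} → iter σ a x ≡ iter σ a y → x ≡ y
iter-injective σ perm zero    eq = eq
iter-injective σ perm (suc a) eq = iter-injective σ perm a (perm _ _ eq)

iter-*-fixed : ∀ {m} (σ : Fun m) p x → iter σ p x ≡ x → ∀ q → iter σ (q * p) x ≡ x
iter-*-fixed σ p x fixed zero    = refl
iter-*-fixed σ p x fixed (suc q) =
  trans (iter-+ σ p (q * p) x) (trans (cong (iter σ p) (iter-*-fixed σ p x fixed q)) fixed)

Reach : ∀ {m} → Fun m → Fin m → Fin m → Set
Reach σ x y = ∃ λ k → iter σ k x ≡ y

Reach-trans : ∀ {m} (σ : Fun m) {x y z} → Reach σ x y → Reach σ y z → Reach σ x z
Reach-trans σ {x} (a , xa≡y) (b , yb≡z) = b + a , trans (iter-+ σ b a x) (trans (cong (iter σ b) xa≡y) yb≡z)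

iter-period : ∀ {m} (σ : Fun m) → IsPerm σ → (x : Fin m) → ∃ λ p → 1 ≤ p × p ≤ m × iter σ p x ≡ x
iter-period {suc m} σ perm x with pigeonhole (n<1+n (suc m)) (λ t → iter σ (toℕ t) x)
... | i , j , i<j , xi≡xj =
  toℕ j ∸ toℕ i , m<n⇒0<n∸m i<j , ≤-trans (m∸n≤m (toℕ j) (toℕ i)) (≤-pred (toℕ<n j)) ,
  iter-injective σ perm (toℕ i) shifted
  where
  shifted : iter σ (toℕ i) (iter σ (toℕ j ∸ toℕ i) x) ≡ iter σ (toℕ i) x
  shifted = trans (sym (iter-+ σ (toℕ i) _ x))
                  (trans (cong (λ k → iter σ k x) (trans (+-comm (toℕ i) _) (m∸n+n≡m (<⇒≤ i<j))))
                         (sym xi≡xj))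

Reach⇒InCycle : ∀ {m} (σ : Fun m) → IsPerm σ → ∀ {x y} → Reach σ x y → InCycle σ x y
Reach⇒InCycle {m} σ perm {x} (k , xk≡y) with iter-period σ perm x
... | suc p , _ , p<m , period =
  Fin.fromℕ< k%p<m , trans (cong (λ k → iter σ k x) (toℕ-fromℕ< k%p<m)) (trans (sym reduce) xk≡y)
  where
  k%p<m : k % suc p < m
  k%p<m = ≤-trans (m%n<n k (suc p)) p<m
  reduce : iter σ k x ≡ iter σ (k % suc p) x
  reduce = trans (cong (λ k → iter σ k x) (m≡m%n+[m/n]*n k (suc p)))
                 (trans (iter-+ σ (k % suc p) _ x)
                        (cong (iter σ (k % suc p)) (iter-*-fixed σ (suc p) x period (k / suc p))))

InCycle⇒Reach : ∀ {m} (σ : Fun m) {x y} → InCycle σ x y → Reach σ x y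
InCycle⇒Reach σ (k , xk≡y) = toℕ k , xk≡y

-- walk σ t x is the word σ(x), σ²(x), … cut after its first 1 (that is, fz) and after
-- at most t letters; walkFrom σ t y is that word when its first letter is y.
walk walkFrom : ∀ {n} → Fun (suc n) → ℕ → Fin (suc n) → List (Fin (suc n))
walk     σ zero    x      = []
walk     σ (suc t) x      = walkFrom σ t (lookup σ x)
walkFrom σ t       fz     = fz ∷ []
walkFrom σ t       (fs y) = fs y ∷ walk σ t (fs y)

Closes ClosesFrom : ∀ {n} → Fun (suc n) → ℕ → Fin (suc n) → Set
Closes     σ zero    x      = ⊥
Closes     σ (suc t) x      = ClosesFrom σ t (lookup σ x)
ClosesFrom σ t       fz     = ⊤
ClosesFrom σ t       (fs y) = Closes σ t (fs y)

applyUpTo-cong : ∀ {A : Set} {f g : ℕ → A} n → (∀ k → f k ≡ g k) → applyUpTo f n ≡ applyUpTo g n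
applyUpTo-cong zero    f≗g = refl
applyUpTo-cong (suc n) f≗g = cong₂ _∷_ (f≗g 0) (applyUpTo-cong n (λ k → f≗g (suc k)))

untilOne-walk : ∀ {n} (σ : Fun (suc n)) t x →
  untilOne (applyUpTo (λ k → iter σ (suc k) x) t) ≡ walk σ t x
untilOne-walkFrom : ∀ {n} (σ : Fun (suc n)) t y →
  untilOne (y ∷ applyUpTo (λ k → iter σ (suc k) y) t) ≡ walkFrom σ t y
untilOne-walk σ zero    x = refl
untilOne-walk σ (suc t) x =
  trans (cong (λ w → untilOne (lookup σ x ∷ w)) (applyUpTo-cong t (λ k → iter-sucʳ σ (suc k) x)))
        (untilOne-walkFrom σ t (lookup σ x))
untilOne-walkFrom σ t fz     = refl
untilOne-walkFrom σ t (fs y) = cong (fs y ∷_) (untilOne-walk σ t (fs y))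

orbitWord-walk : ∀ {n} (σ : Fun (suc n)) → orbitWord σ ≡ walk σ (suc n) fz
orbitWord-walk {n} σ = trans (cong untilOne (Listₚ.map-upTo _ (suc n))) (untilOne-walk σ (suc n) fz)

walk-stable : ∀ {n} (σ : Fun (suc n)) t x → Closes σ t x → ∀ s → walk σ (t + s) x ≡ walk σ t x
walkFrom-stable : ∀ {n} (σ : Fun (suc n)) t y → ClosesFrom σ t y →
  ∀ s → walkFrom σ (t + s) y ≡ walkFrom σ t y
walk-stable     σ (suc t) x      closes s = walkFrom-stable σ t (lookup σ x) closes s
walkFrom-stable σ t       fz     closes s = refl
walkFrom-stable σ t       (fs y) closes s = cong (fs y ∷_) (walk-stable σ t (fs y) closes s)

iter⇒Closes : ∀ {n} (σ : Fun (suc n)) t x k → 1 ≤ k → k ≤ t → iter σ k x ≡ fz → Closes σ t x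
iter⇒Closes σ zero    x (suc k) _ () _
iter⇒Closes σ (suc t) x k 1≤k k≤t xk≡1 = from (lookup σ x) refl k 1≤k k≤t xk≡1
  where
  from : ∀ y → lookup σ x ≡ y → ∀ k → 1 ≤ k → k ≤ suc t → iter σ k x ≡ fz → ClosesFrom σ t y
  from fz     _    _             _ _         _     = tt
  from (fs y) σx≡y (suc zero)    _ _         σx≡1  with () ← trans (sym σx≡1) σx≡y
  from (fs y) σx≡y (suc (suc k)) _ (s≤s k≤t) xk≡1 =
    iter⇒Closes σ t (fs y) (suc k) (s≤s z≤n) k≤t (iter-suc⇒ σ (suc k) σx≡y xk≡1)

orbit-closes : ∀ {n} (σ : Fun (suc n)) → IsPerm σ → Closes σ (suc n) fz
orbit-closes {n} σ perm with iter-period σ perm fz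
... | p , 1≤p , p≤1+n , period = iter⇒Closes σ (suc n) fz p 1≤p p≤1+n period

walk-head : ∀ {n} (σ : Fun (suc n)) t x → Closes σ t x → ∃ λ w → walk σ t x ≡ lookup σ x ∷ w
walk-head σ (suc t) x _ = head (lookup σ x)
  where
  head : ∀ y → ∃ λ w → walkFrom σ t y ≡ y ∷ w
  head fz     = [] , refl
  head (fs y) = walk σ t (fs y) , refl

-- Inserting a new maximal element

top : ∀ {m} → Fin (suc m)
top {m} = fromℕ m

top≢inject₁ : ∀ {m} {i : Fin m} → top ≢ inject₁ i
top≢inject₁ {i = i} = fromℕ≢inject₁ {i = i}

inject₁<top : ∀ {m} (i : Fin m) → inject₁ i Fin.< top
inject₁<top {m} i = subst₂ _<_ (sym (toℕ-inject₁ i)) (sym (toℕ-fromℕ m)) (toℕ<n i)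

≢top⇒<top : ∀ {m} (x : Fin (suc m)) → x ≢ top → x Fin.< top
≢top⇒<top x x≢top with view x
... | ‵fromℕ     = ⊥-elim (x≢top refl)
... | ‵inject₁ i = inject₁<top i

top≮ : ∀ {m} (y : Fin (suc m)) → ¬ (top Fin.< y)
top≮ {m} y top<y = <⇒≱ top<y (subst (toℕ y ≤_) (sym (toℕ-fromℕ m)) (≤-pred (toℕ<n y)))

newImage : ∀ {m} → Fun m → Maybe (Fin m) → Fin (suc m)
newImage σ nothing  = top
newImage σ (just c) = inject₁ (lookup σ c)

oldImage′ : ∀ {m} → Fun m → (i c : Fin m) → Dec (i ≡ c) → Fin (suc m)
oldImage′ σ i c (yes _) = top
oldImage′ σ i c (no _)  = inject₁ (lookup σ i)

oldImage : ∀ {m} → Fun m → Maybe (Fin m) → Fin m → Fin (suc m)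
oldImage σ nothing  i = inject₁ (lookup σ i)
oldImage σ (just c) i = oldImage′ σ i c (i ≟F c)

image : ∀ {m} → Fun m → Maybe (Fin m) → {x : Fin (suc m)} → View x → Fin (suc m)
image σ o ‵fromℕ       = newImage σ o
image σ o (‵inject₁ i) = oldImage σ o i

-- The new element top is either added as a fixed point (o = nothing) or
-- inserted into a cycle right after c (o = just c).
insertMax : ∀ {m} → Fun m → Maybe (Fin m) → Fun (suc m)
insertMax σ o = Vec.tabulate (λ x → image σ o (view x))

module _ {m : ℕ} (σ : Fun m) (o : Maybe (Fin m)) where

  insertMax-lookup : ∀ x → lookup (insertMax σ o) x ≡ image σ o (view x)
  insertMax-lookup x = Vecₚ.lookup∘tabulate (λ x → image σ o (view x)) x

  insertMax-top : lookup (insertMax σ o) top ≡ newImage σ o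
  insertMax-top = trans (insertMax-lookup top) (cong (image σ o) (view-fromℕ m))

  insertMax-inject₁ : ∀ i → lookup (insertMax σ o) (inject₁ i) ≡ oldImage σ o i
  insertMax-inject₁ i = trans (insertMax-lookup (inject₁ i)) (cong (image σ o) (view-inject₁ i))

insertMax-inject₁-cases : ∀ {m} (σ : Fun m) o i →
  (o ≡ just i × lookup (insertMax σ o) (inject₁ i) ≡ top) ⊎
  (o ≢ just i × lookup (insertMax σ o) (inject₁ i) ≡ inject₁ (lookup σ i))
insertMax-inject₁-cases σ nothing  i = inj₂ ((λ ()) , insertMax-inject₁ σ nothing i)
insertMax-inject₁-cases σ (just c) i with i ≟F c | insertMax-inject₁ σ (just c) i
... | yes refl | eq = inj₁ (refl , eq)
... | no i≢c   | eq = inj₂ ((λ { refl → i≢c refl }) , eq)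

insertMax-top-just : ∀ {m} (σ : Fun m) {o} c → o ≡ just c →
  lookup (insertMax σ o) top ≡ inject₁ (lookup σ c)
insertMax-top-just σ c refl = insertMax-top σ (just c)

insertMax-top-nothing : ∀ {m} (σ : Fun m) {o} → o ≡ nothing → lookup (insertMax σ o) top ≡ top
insertMax-top-nothing σ refl = insertMax-top σ nothing

IsPerm-insertMax⁺ : ∀ {m} (σ : Fun m) o → IsPerm σ → IsPerm (insertMax σ o)
IsPerm-insertMax⁺ {m} σ o perm x y eq
  with view x | view y | trans (sym (insertMax-lookup σ o x)) (trans eq (insertMax-lookup σ o y))
... | ‵fromℕ       | ‵fromℕ       | _  = refl
... | ‵fromℕ       | ‵inject₁ j   | eq′ = ⊥-elim (new≢old o j eq′)
  where
  new≢old : ∀ o j → newImage σ o ≢ oldImage σ o j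
  new≢old nothing  j eq = top≢inject₁ eq
  new≢old (just c) j eq with j ≟F c
  ... | yes _   = top≢inject₁ (sym eq)
  ... | no j≢c = j≢c (sym (perm c j (inject₁-injective eq)))
... | ‵inject₁ i   | ‵fromℕ       | eq′ = ⊥-elim (old≢new o i eq′)
  where
  old≢new : ∀ o i → oldImage σ o i ≢ newImage σ o
  old≢new nothing  i eq = top≢inject₁ (sym eq)
  old≢new (just c) i eq with i ≟F c
  ... | yes _   = top≢inject₁ eq
  ... | no i≢c = i≢c (perm i c (inject₁-injective eq))
... | ‵inject₁ i   | ‵inject₁ j   | eq′ = cong inject₁ (old-injective o i j eq′)
  where
  old-injective : ∀ o i j → oldImage σ o i ≡ oldImage σ o j → i ≡ j
  old-injective nothing  i j eq = perm i j (inject₁-injective eq)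
  old-injective (just c) i j eq with i ≟F c | j ≟F c
  ... | yes i≡c | yes j≡c = trans i≡c (sym j≡c)
  ... | yes _   | no _    = ⊥-elim (top≢inject₁ eq)
  ... | no _    | yes _   = ⊥-elim (top≢inject₁ (sym eq))
  ... | no _    | no _    = perm i j (inject₁-injective eq)

IsPerm-insertMax⁻ : ∀ {m} (σ : Fun m) o → IsPerm (insertMax σ o) → IsPerm σ
IsPerm-insertMax⁻ σ nothing perm i j eq =
  inject₁-injective (perm (inject₁ i) (inject₁ j)
    (trans (insertMax-inject₁ σ nothing i) (trans (cong inject₁ eq) (sym (insertMax-inject₁ σ nothing j)))))
IsPerm-insertMax⁻ σ (just c) perm i j eq
  with i ≟F c | j ≟F c | insertMax-inject₁ σ (just c) i | insertMax-inject₁ σ (just c) j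
... | yes i≡c  | yes j≡c | _   | _   = trans i≡c (sym j≡c)
... | yes refl | no _    | _   | σ̂j = ⊥-elim (top≢inject₁
  (perm top (inject₁ j) (trans (insertMax-top σ (just i)) (trans (cong inject₁ eq) (sym σ̂j)))))
... | no _     | yes refl | σ̂i | _  = ⊥-elim (top≢inject₁ (sym
  (perm (inject₁ i) top (trans σ̂i (trans (cong inject₁ eq) (sym (insertMax-top σ (just j))))))))
... | no _     | no _    | σ̂i | σ̂j =
  inject₁-injective (perm _ _ (trans σ̂i (trans (cong inject₁ eq) (sym σ̂j))))

module _ {m : ℕ} (σ : Fun m) (o : Maybe (Fin m)) where

  private
    σ̂ = insertMax σ o

  Reach-inject₁-step : ∀ x → Reach σ̂ (inject₁ x) (inject₁ (lookup σ x))
  Reach-inject₁-step x with insertMax-inject₁-cases σ o x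
  ... | inj₁ (o≡x , σ̂x≡top) = 2 , trans (cong (lookup σ̂) σ̂x≡top) (insertMax-top-just σ x o≡x)
  ... | inj₂ (_ , σ̂x≡σx)    = 1 , σ̂x≡σx

  Reach-inject₁⁺ : ∀ k x {y} → iter σ k x ≡ y → Reach σ̂ (inject₁ x) (inject₁ y)
  Reach-inject₁⁺ zero    x xk≡y = 0 , cong inject₁ xk≡y
  Reach-inject₁⁺ (suc k) x xk≡y =
    Reach-trans σ̂ (Reach-inject₁-step x) (Reach-inject₁⁺ k (lookup σ x) (trans (sym (iter-sucʳ σ k x)) xk≡y))

  Reach-inject₁⁻ : ∀ k x {y} → iter σ̂ k (inject₁ x) ≡ inject₁ y → Reach σ x y
  Reach-inject₁⁻ zero    x xk≡y = 0 , inject₁-injective xk≡y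
  Reach-inject₁⁻ (suc k) x {y} xk≡y with insertMax-inject₁-cases σ o x
  ... | inj₂ (_ , σ̂x≡σx)    = fromImage k (iter-suc⇒ σ̂ k σ̂x≡σx xk≡y)
    where
    fromImage : ∀ k → iter σ̂ k (inject₁ (lookup σ x)) ≡ inject₁ y → Reach σ x y
    fromImage k eq = let (k′ , eq′) = Reach-inject₁⁻ k (lookup σ x) eq in suc k′ , trans (iter-sucʳ σ k′ x) eq′
  ... | inj₁ (o≡x , σ̂x≡top) = fromTop k (iter-suc⇒ σ̂ k σ̂x≡top xk≡y)
    where
    fromTop : ∀ k → iter σ̂ k top ≡ inject₁ y → Reach σ x y
    fromTop zero    top≡y = ⊥-elim (top≢inject₁ top≡y)
    fromTop (suc k) eq    =
      let (k′ , eq′) = Reach-inject₁⁻ k (lookup σ x) (iter-suc⇒ σ̂ k (insertMax-top-just σ x o≡x) eq)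
      in suc k′ , trans (iter-sucʳ σ k′ x) eq′

  iter-top-fixed : o ≡ nothing → ∀ k → iter σ̂ k top ≡ top
  iter-top-fixed o≡nothing zero    = refl
  iter-top-fixed o≡nothing (suc k) =
    trans (cong (lookup σ̂) (iter-top-fixed o≡nothing k)) (insertMax-top-nothing σ o≡nothing)

IsCycleMinᴿ : ∀ {m} → Fun m → Fin m → Set
IsCycleMinᴿ τ i = ∀ j → Reach τ i j → i Fin.≤ j

IsCycleMin⇒ᴿ : ∀ {m} (τ : Fun m) → IsPerm τ → ∀ i → IsCycleMin τ i → IsCycleMinᴿ τ i
IsCycleMin⇒ᴿ τ perm i min j reach = min j (Reach⇒InCycle τ perm reach)

IsCycleMinᴿ⇒ : ∀ {m} (τ : Fun m) i → IsCycleMinᴿ τ i → IsCycleMin τ i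
IsCycleMinᴿ⇒ τ i min j inCycle = min j (InCycle⇒Reach τ inCycle)

module _ {m : ℕ} (σ : Fun m) (o : Maybe (Fin m)) where

  private
    σ̂ = insertMax σ o

  IsCycleMinᴿ-inject₁⁻ : ∀ i → IsCycleMinᴿ σ̂ (inject₁ i) → IsCycleMinᴿ σ i
  IsCycleMinᴿ-inject₁⁻ i min j (k , ik≡j) =
    subst₂ _≤_ (toℕ-inject₁ i) (toℕ-inject₁ j) (min (inject₁ j) (Reach-inject₁⁺ σ o k i ik≡j))

  IsCycleMinᴿ-inject₁⁺ : ∀ i → IsCycleMinᴿ σ i → IsCycleMinᴿ σ̂ (inject₁ i)
  IsCycleMinᴿ-inject₁⁺ i min j (k , ik≡j) with view j
  ... | ‵fromℕ      = <⇒≤ (inject₁<top i)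
  ... | ‵inject₁ j′ = subst₂ _≤_ (sym (toℕ-inject₁ i)) (sym (toℕ-inject₁ j′)) (min j′ (Reach-inject₁⁻ σ o k i ik≡j))

  IsCycleMinᴿ-top⁺ : o ≡ nothing → IsCycleMinᴿ σ̂ top
  IsCycleMinᴿ-top⁺ o≡nothing j (k , topk≡j) = subst (top Fin.≤_) (trans (sym (iter-top-fixed σ o o≡nothing k)) topk≡j) ≤-refl

IsCycleMinᴿ-top⁻ : ∀ {m} (σ : Fun m) o → IsCycleMinᴿ (insertMax σ o) top → o ≡ nothing
IsCycleMinᴿ-top⁻ σ nothing  _   = refl
IsCycleMinᴿ-top⁻ σ (just c) min = ⊥-elim (<⇒≱ σ̂top<top (min _ (1 , refl)))
  where
  σ̂top<top : lookup (insertMax σ (just c)) top Fin.< top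
  σ̂top<top = subst (Fin._< top) (sym (insertMax-top σ (just c))) (inject₁<top (lookup σ c))

minima : ∀ {m} → Fun m → Vec Bool m
minima τ = Vec.tabulate (λ i → does (isCycleMin? τ i))

lookup-minima : ∀ {m} (τ : Fun m) i → lookup (minima τ) i ≡ does (isCycleMin? τ i)
lookup-minima τ i = Vecₚ.lookup∘tabulate (λ i → does (isCycleMin? τ i)) i

lookup-extensionality : ∀ {A : Set} {n} (v w : Vec A n) → (∀ i → lookup v i ≡ lookup w i) → v ≡ w
lookup-extensionality v w eq = trans (sym (Vecₚ.tabulate∘lookup v)) (trans (Vecₚ.tabulate-cong eq) (Vecₚ.tabulate∘lookup w))

lookup-∷ʳ-inject₁ : ∀ {A : Set} {n} (v : Vec A n) x i → lookup (v ∷ʳ x) (inject₁ i) ≡ lookup v i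
lookup-∷ʳ-inject₁ (y ∷ v) x fz     = refl
lookup-∷ʳ-inject₁ (y ∷ v) x (fs i) = lookup-∷ʳ-inject₁ v x i

lookup-∷ʳ-top : ∀ {A : Set} {n} (v : Vec A n) x → lookup (v ∷ʳ x) top ≡ x
lookup-∷ʳ-top []      x = refl
lookup-∷ʳ-top (y ∷ v) x = lookup-∷ʳ-top v x

minima-insertMax : ∀ {m} (σ : Fun m) o → IsPerm σ → minima (insertMax σ o) ≡ minima σ ∷ʳ is-nothing o
minima-insertMax {m} σ o perm = lookup-extensionality _ _ λ x →
  trans (lookup-minima σ̂ x) (at x (view x))
  where
  σ̂ = insertMax σ o
  perm̂ = IsPerm-insertMax⁺ σ o perm
  at : ∀ x → View x → does (isCycleMin? σ̂ x) ≡ lookup (minima σ ∷ʳ is-nothing o) x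
  at _ ‵fromℕ = trans (isMin-top o refl) (sym (lookup-∷ʳ-top (minima σ) (is-nothing o)))
    where
    isMin-top : ∀ o′ → o ≡ o′ → does (isCycleMin? σ̂ top) ≡ is-nothing o′
    isMin-top nothing  o≡nothing = dec-true (isCycleMin? σ̂ top) (IsCycleMinᴿ⇒ σ̂ top (IsCycleMinᴿ-top⁺ σ o o≡nothing))
    isMin-top (just c) o≡c       = dec-false (isCycleMin? σ̂ top) λ min →
      case trans (sym o≡c) (IsCycleMinᴿ-top⁻ σ o (IsCycleMin⇒ᴿ σ̂ perm̂ top min)) of λ ()
  at _ (‵inject₁ i) = begin
    does (isCycleMin? σ̂ (inject₁ i))
      ≡⟨ does-⇔ (mk⇔ to from) (isCycleMin? σ̂ (inject₁ i)) (isCycleMin? σ i) ⟩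
    does (isCycleMin? σ i)
      ≡⟨ lookup-minima σ i ⟨
    lookup (minima σ) i
      ≡⟨ lookup-∷ʳ-inject₁ (minima σ) (is-nothing o) i ⟨
    lookup (minima σ ∷ʳ is-nothing o) (inject₁ i) ∎
    where
    open ≡-Reasoning
    to : IsCycleMin σ̂ (inject₁ i) → IsCycleMin σ i
    to min = IsCycleMinᴿ⇒ σ i (IsCycleMinᴿ-inject₁⁻ σ o i (IsCycleMin⇒ᴿ σ̂ perm̂ (inject₁ i) min))
    from : IsCycleMin σ i → IsCycleMin σ̂ (inject₁ i)
    from min = IsCycleMinᴿ⇒ σ̂ (inject₁ i) (IsCycleMinᴿ-inject₁⁺ σ o i (IsCycleMin⇒ᴿ σ perm i min))

Sep-insertMax⁻ : ∀ {k} (σ : Fun (2 + k)) o → IsPerm σ → Sep (2 + k) (insertMax σ o) → Sep (suc k) σ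
Sep-insertMax⁻ σ o perm sep inCycle with InCycle⇒Reach σ inCycle
... | k , 1k≡2 = sep (Reach⇒InCycle (insertMax σ o) (IsPerm-insertMax⁺ σ o perm) (Reach-inject₁⁺ σ o k fz 1k≡2))

Sep-insertMax⁺ : ∀ {k} (σ : Fun (2 + k)) o → IsPerm σ → Sep (suc k) σ → Sep (2 + k) (insertMax σ o)
Sep-insertMax⁺ σ o perm sep inCycle with InCycle⇒Reach (insertMax σ o) inCycle
... | k , 1k≡2 = sep (Reach⇒InCycle σ perm (Reach-inject₁⁻ σ o k fz 1k≡2))

removeTop : ∀ {m} → List (Fin (suc m)) → List (Fin (suc m))
removeTop = filter (λ y → ¬? (y ≟F top))

removeTop-top : ∀ {m} (ys : List (Fin (suc m))) → removeTop (top ∷ ys) ≡ removeTop ys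
removeTop-top ys = Listₚ.filter-reject (λ y → ¬? (y ≟F top)) (λ top≢top → top≢top refl)

removeTop-≢ : ∀ {m} {y : Fin (suc m)} ys → y ≢ top → removeTop (y ∷ ys) ≡ y ∷ removeTop ys
removeTop-≢ ys = Listₚ.filter-accept (λ y → ¬? (y ≟F top))

removeTop-∷ʳ : ∀ {m} (p : List (Fin (suc m))) x → removeTop (p ++ [ x ]) ≡ removeTop p ++ removeTop [ x ]
removeTop-∷ʳ p x = Listₚ.filter-++ (λ y → ¬? (y ≟F top)) p [ x ]

All-removeTop⁻ : ∀ {m} {x : Fin (suc m)} → x ≢ top → ∀ p → All (x Fin.<_) (removeTop p) → All (x Fin.<_) p
All-removeTop⁻ x≢top []      _ = []
All-removeTop⁻ x≢top (y ∷ p) all with y ≟F top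
... | yes refl = ≢top⇒<top _ x≢top ∷ All-removeTop⁻ x≢top p all
... | no _ with all
...   | x<y ∷ all′ = x<y ∷ All-removeTop⁻ x≢top p all′

topOpens : ∀ {m} → List (Fin (suc m)) → List (Fin (suc m)) → ℕ
topOpens []      []      = 0
topOpens []      (y ∷ w) = indicator (y ≟F top)
topOpens (_ ∷ _) _       = 0

topOpens-∷ʳ : ∀ {m} (p : List (Fin (suc m))) x w → topOpens (p ++ [ x ]) w ≡ 0
topOpens-∷ʳ []      x w = refl
topOpens-∷ʳ (_ ∷ _) x w = refl

isRecord : ∀ {m} → Fin m → List (Fin m) → ℕ
isRecord x p = indicator (All.all? (x <?F_) p)

topOpens-≢ : ∀ {m} (p : List (Fin (suc m))) {x} w → x ≢ top → topOpens p (x ∷ w) ≡ 0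
topOpens-≢ []      {x} w x≢top = indicator-no (x ≟F top) x≢top
topOpens-≢ (_ ∷ _)     w _     = refl

All-removeTop⇔ : ∀ {m} {x : Fin (suc m)} → x ≢ top → ∀ p → All (x Fin.<_) p ⇔ All (x Fin.<_) (removeTop p)
All-removeTop⇔ x≢top p = mk⇔ (Allₚ.filter⁺ (λ y → ¬? (y ≟F top))) (All-removeTop⁻ x≢top p)

-- top, being larger than every other letter, is a record only as the first letter,
-- and deleting it does not change which other letters are records.
recAux-removeTop : ∀ {m} (p w : List (Fin (suc m))) → recAux p w ≡ recAux (removeTop p) (removeTop w) + topOpens p w
recAux-removeTop-∷ʳ : ∀ {m} (p : List (Fin (suc m))) x w →
  recAux (p ++ [ x ]) w ≡ recAux (removeTop p ++ removeTop [ x ]) (removeTop w)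

recAux-removeTop []      []      = refl
recAux-removeTop (_ ∷ _) []      = refl
recAux-removeTop {m} p (x ∷ w) with x ≟F top
... | yes refl = begin
  isRecord top p + recAux (p ++ [ top ]) w
    ≡⟨ cong₂ _+_ (isRecord-top p) (recAux-removeTop-∷ʳ p top w) ⟩
  topOpens p (top ∷ w) + recAux (removeTop p ++ removeTop [ top ]) (removeTop w)
    ≡⟨ cong (λ q → topOpens p (top ∷ w) + recAux q (removeTop w))
            (trans (cong (removeTop p ++_) (removeTop-top [])) (Listₚ.++-identityʳ _)) ⟩
  topOpens p (top ∷ w) + recAux (removeTop p) (removeTop w)
    ≡⟨ +-comm (topOpens p (top ∷ w)) _ ⟩
  recAux (removeTop p) (removeTop w) + topOpens p (top ∷ w) ∎
  where
  open ≡-Reasoning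
  isRecord-top : ∀ p → isRecord top p ≡ topOpens p (top ∷ w)
  isRecord-top []      = sym (indicator-yes (top {m} ≟F top) refl)
  isRecord-top (y ∷ p) = indicator-no (All.all? (top <?F_) (y ∷ p)) λ { (top<y ∷ _) → top≮ y top<y }
... | no x≢top = begin
  isRecord x p + recAux (p ++ [ x ]) w
    ≡⟨ cong₂ _+_ (indicator-⇔ (All-removeTop⇔ x≢top p) (All.all? (x <?F_) p) (All.all? (x <?F_) (removeTop p)))
                 (recAux-removeTop-∷ʳ p x w) ⟩
  isRecord x (removeTop p) + recAux (removeTop p ++ removeTop [ x ]) (removeTop w)
    ≡⟨ cong (λ q → isRecord x (removeTop p) + recAux (removeTop p ++ q) (removeTop w)) (removeTop-≢ [] x≢top) ⟩
  recAux (removeTop p) (x ∷ removeTop w)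
    ≡⟨ +-identityʳ _ ⟨
  recAux (removeTop p) (x ∷ removeTop w) + 0
    ≡⟨ cong (recAux (removeTop p) (x ∷ removeTop w) +_) (topOpens-≢ p w x≢top) ⟨
  recAux (removeTop p) (x ∷ removeTop w) + topOpens p (x ∷ w) ∎
  where open ≡-Reasoning

recAux-removeTop-∷ʳ p x w = begin
  recAux (p ++ [ x ]) w
    ≡⟨ recAux-removeTop (p ++ [ x ]) w ⟩
  recAux (removeTop (p ++ [ x ])) (removeTop w) + topOpens (p ++ [ x ]) w
    ≡⟨ cong₂ (λ q t → recAux q (removeTop w) + t) (removeTop-∷ʳ p x) (topOpens-∷ʳ p x w) ⟩
  recAux (removeTop p ++ removeTop [ x ]) (removeTop w) + 0
    ≡⟨ +-identityʳ _ ⟩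
  recAux (removeTop p ++ removeTop [ x ]) (removeTop w) ∎
  where open ≡-Reasoning

recAux-map-inject₁ : ∀ {m} (p w : List (Fin m)) → recAux (map inject₁ p) (map inject₁ w) ≡ recAux p w
recAux-map-inject₁ p []      = refl
recAux-map-inject₁ p (x ∷ w) =
  cong₂ _+_ (indicator-⇔ All-map-inject₁⇔ (All.all? (inject₁ x <?F_) (map inject₁ p)) (All.all? (x <?F_) p))
            (trans (cong (λ q → recAux q (map inject₁ w)) (sym (Listₚ.map-++ inject₁ p [ x ])))
                   (recAux-map-inject₁ (p ++ [ x ]) w))
  where
  All-map-inject₁⇔ : All (inject₁ x Fin.<_) (map inject₁ p) ⇔ All (x Fin.<_) p
  All-map-inject₁⇔ = mk⇔
    (λ all → All.map (λ {y} → subst₂ _<_ (toℕ-inject₁ x) (toℕ-inject₁ y)) (Allₚ.map⁻ all))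
    (λ all → Allₚ.map⁺ (All.map (λ {y} → subst₂ _<_ (sym (toℕ-inject₁ x)) (sym (toℕ-inject₁ y))) all))

fz≢top : ∀ {n} → fz {suc n} ≢ top
fz≢top ()

module _ {n : ℕ} (σ : Fun (suc n)) (o : Maybe (Fin (suc n))) where

  private
    σ̂ = insertMax σ o

  walk-insertMax : ∀ t x → Closes σ t x →
    ∃ λ t′ → Closes σ̂ t′ (inject₁ x) × removeTop (walk σ̂ t′ (inject₁ x)) ≡ map inject₁ (walk σ t x)
  walk-insertMax-from : ∀ t z y → lookup σ̂ z ≡ inject₁ y → ClosesFrom σ t y →
    ∃ λ t′ → Closes σ̂ (suc t′) z × removeTop (walk σ̂ (suc t′) z) ≡ map inject₁ (walkFrom σ t y)

  walk-insertMax (suc t) x closes with insertMax-inject₁-cases σ o x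
  ... | inj₂ (_ , σ̂x≡σx) = let (t′ , closes′ , eq) = walk-insertMax-from t (inject₁ x) (lookup σ x) σ̂x≡σx closes
                           in suc t′ , closes′ , eq
  ... | inj₁ (o≡x , σ̂x≡top) =
    let (t′ , closes′ , eq) = walk-insertMax-from t top (lookup σ x) (insertMax-top-just σ x o≡x) closes
    in suc (suc t′) , subst (ClosesFrom σ̂ (suc t′)) (sym σ̂x≡top) closes′ ,
       trans (cong (λ v → removeTop (walkFrom σ̂ (suc t′) v)) σ̂x≡top) (trans (removeTop-top _) eq)

  walk-insertMax-from t z fz σ̂z≡1 _ =
    0 , subst (ClosesFrom σ̂ 0) (sym σ̂z≡1) tt ,
    trans (cong (λ v → removeTop (walkFrom σ̂ 0 v)) σ̂z≡1) (removeTop-≢ [] fz≢top)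
  walk-insertMax-from t z (fs y) σ̂z≡y closes =
    let (t′ , closes′ , eq) = walk-insertMax t (fs y) closes
    in t′ , subst (ClosesFrom σ̂ t′) (sym σ̂z≡y) closes′ ,
       trans (cong (λ v → removeTop (walkFrom σ̂ t′ v)) σ̂z≡y)
             (trans (removeTop-≢ _ (λ y≡top → top≢inject₁ (sym y≡top))) (cong (fs (inject₁ y) ∷_) eq))

insertsAfter1 : ∀ {n} → Maybe (Fin (suc n)) → ℕ
insertsAfter1 (just fz)     = 1
insertsAfter1 (just (fs _)) = 0
insertsAfter1 nothing       = 0

rec-insertMax : ∀ {n} (σ : Fun (suc n)) o → IsPerm σ → rec (insertMax σ o) ≡ rec σ + insertsAfter1 o
rec-insertMax {n} σ o perm with walk-insertMax σ o (suc n) fz (orbit-closes σ perm)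
... | t′ , closes , removeTop-ŵ≡w = begin
  recW (orbitWord σ̂)
    ≡⟨ cong recW orbitWord-ŵ ⟩
  recAux [] ŵ
    ≡⟨ recAux-removeTop [] ŵ ⟩
  recAux [] (removeTop ŵ) + topOpens [] ŵ
    ≡⟨ cong₂ _+_ (cong (recAux []) removeTop-ŵ≡w) opens ⟩
  recAux [] (map inject₁ (walk σ (suc n) fz)) + insertsAfter1 o
    ≡⟨ cong (_+ insertsAfter1 o) (recAux-map-inject₁ [] (walk σ (suc n) fz)) ⟩
  recAux [] (walk σ (suc n) fz) + insertsAfter1 o
    ≡⟨ cong (λ w → recW w + insertsAfter1 o) (orbitWord-walk σ) ⟨
  rec σ + insertsAfter1 o ∎
  where
  open ≡-Reasoning
  σ̂ = insertMax σ o
  ŵ = walk σ̂ t′ fz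
  orbitWord-ŵ : orbitWord σ̂ ≡ ŵ
  orbitWord-ŵ = begin
    orbitWord σ̂
      ≡⟨ orbitWord-walk σ̂ ⟩
    walk σ̂ (2 + n) fz
      ≡⟨ walk-stable σ̂ (2 + n) fz (orbit-closes σ̂ (IsPerm-insertMax⁺ σ o perm)) t′ ⟨
    walk σ̂ (2 + n + t′) fz
      ≡⟨ cong (λ k → walk σ̂ k fz) (+-comm (2 + n) t′) ⟩
    walk σ̂ (t′ + (2 + n)) fz
      ≡⟨ walk-stable σ̂ t′ fz closes (2 + n) ⟩
    ŵ ∎
  opensAt : ∀ v w → lookup σ̂ fz ≡ v → topOpens [] (v ∷ w) ≡ insertsAfter1 o
  opensAt v w σ̂1≡v with insertMax-inject₁-cases σ o fz
  ... | inj₁ (refl , σ̂1≡top) = indicator-yes (v ≟F top) (trans (sym σ̂1≡v) σ̂1≡top)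
  ... | inj₂ (o≢1 , σ̂1≡σ1)  =
    trans (indicator-no (v ≟F top) (λ v≡top → top≢inject₁ (trans (sym v≡top) (trans (sym σ̂1≡v) σ̂1≡σ1))))
          (not-after1 o o≢1)
    where
    not-after1 : ∀ o → o ≢ just fz → 0 ≡ insertsAfter1 o
    not-after1 nothing       _    = refl
    not-after1 (just fz)     o≢1 = ⊥-elim (o≢1 refl)
    not-after1 (just (fs _)) _    = refl
  opens : topOpens [] ŵ ≡ insertsAfter1 o
  opens with walk-head σ̂ t′ fz closes
  ... | w , ŵ≡σ̂1∷w = trans (cong (topOpens []) ŵ≡σ̂1∷w) (opensAt (lookup σ̂ fz) w refl)

-- Removing the maximal element

lowerView : ∀ {m} {x : Fin (2 + m)} → View x → Fin (suc m)
lowerView ‵fromℕ       = fz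
lowerView (‵inject₁ i) = i

-- the inverse of inject₁, with the junk value 1 at top
lower : ∀ {m} → Fin (2 + m) → Fin (suc m)
lower x = lowerView (view x)

lower-inject₁ : ∀ {m} (i : Fin (suc m)) → lower (inject₁ i) ≡ i
lower-inject₁ i = cong lowerView (view-inject₁ i)

inject₁-lower : ∀ {m} (x : Fin (2 + m)) → x ≢ top → inject₁ (lower x) ≡ x
inject₁-lower x x≢top with view x
... | ‵fromℕ     = ⊥-elim (x≢top refl)
... | ‵inject₁ i = refl

skipTop : ∀ {m} → Fin (suc m) → Fin (suc m) → Fin (suc m)
skipTop y z = if does (y ≟F top) then z else y

skipTop-top : ∀ {m} {y z : Fin (suc m)} → y ≡ top → skipTop y z ≡ z
skipTop-top {y = y} {z} y≡top = cong (λ b → if b then z else y) (dec-true (y ≟F top) y≡top)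

skipTop-≢ : ∀ {m} {y z : Fin (suc m)} → y ≢ top → skipTop y z ≡ y
skipTop-≢ {y = y} {z} y≢top = cong (λ b → if b then z else y) (dec-false (y ≟F top) y≢top)

module _ {m′ : ℕ} where

  private
    m = suc m′

  removeMax : Fun (suc m) → Fun m
  removeMax σ = Vec.tabulate (λ i → lower (skipTop (lookup σ (inject₁ i)) (lookup σ top)))

  lookup-removeMax : ∀ σ i → lookup (removeMax σ) i ≡ lower (skipTop (lookup σ (inject₁ i)) (lookup σ top))
  lookup-removeMax σ = Vecₚ.lookup∘tabulate (λ i → lower (skipTop (lookup σ (inject₁ i)) (lookup σ top)))

  findTop : Fun (suc m) → Maybe (Fin m)
  findTop σ = Maybe.map proj₁ (dec⇒maybe (any? (λ i → lookup σ (inject₁ i) ≟F top)))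

  findTop-cases : ∀ σ →
    (∃ λ c → findTop σ ≡ just c × lookup σ (inject₁ c) ≡ top) ⊎ (∀ i → lookup σ (inject₁ i) ≢ top)
  findTop-cases σ with any? (λ i → lookup σ (inject₁ i) ≟F top)
  ... | yes (c , σc≡top) = inj₁ (c , refl , σc≡top)
  ... | no ∄c           = inj₂ (λ i σi≡top → ∄c (i , σi≡top))

  topPredecessor : Fun (suc m) → Maybe (Fin m)
  topPredecessor σ = if does (lookup σ top ≟F top) then nothing else findTop σ

  topPredecessor-fixed : ∀ σ → lookup σ top ≡ top → topPredecessor σ ≡ nothing
  topPredecessor-fixed σ σtop≡top =
    cong (λ b → if b then nothing else findTop σ) (dec-true (lookup σ top ≟F top) σtop≡top)

  topPredecessor-moved : ∀ σ → lookup σ top ≢ top → topPredecessor σ ≡ findTop σ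
  topPredecessor-moved σ σtop≢top =
    cong (λ b → if b then nothing else findTop σ) (dec-false (lookup σ top ≟F top) σtop≢top)

  removeMax-insertMax : ∀ (σ : Fun m) o → removeMax (insertMax σ o) ≡ σ
  removeMax-insertMax σ o = lookup-extensionality _ _ λ i →
    trans (lookup-removeMax (insertMax σ o) i) (at i (insertMax-inject₁-cases σ o i))
    where
    at : ∀ i → _ → lower (skipTop (lookup (insertMax σ o) (inject₁ i)) (lookup (insertMax σ o) top)) ≡ lookup σ i
    at i (inj₁ (o≡i , σ̂i≡top)) =
      trans (cong lower (trans (skipTop-top σ̂i≡top) (insertMax-top-just σ i o≡i))) (lower-inject₁ _)
    at i (inj₂ (_ , σ̂i≡σi)) =
      trans (cong lower (trans (skipTop-≢ (λ σ̂i≡top → top≢inject₁ (trans (sym σ̂i≡top) σ̂i≡σi))) σ̂i≡σi))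
            (lower-inject₁ _)

  topPredecessor-insertMax : ∀ (σ : Fun m) o → topPredecessor (insertMax σ o) ≡ o
  topPredecessor-insertMax σ nothing  = topPredecessor-fixed (insertMax σ nothing) (insertMax-top σ nothing)
  topPredecessor-insertMax σ (just c) =
    trans (topPredecessor-moved σ̂ (λ σ̂top≡top → top≢inject₁ (trans (sym σ̂top≡top) (insertMax-top σ (just c)))))
          (found (findTop-cases σ̂))
    where
    σ̂ = insertMax σ (just c)
    found : _ → findTop σ̂ ≡ just c
    found (inj₁ (c′ , found≡c′ , σ̂c′≡top)) with insertMax-inject₁-cases σ (just c) c′
    ... | inj₁ (refl , _)   = found≡c′
    ... | inj₂ (_ , σ̂c′≡σc′) = ⊥-elim (top≢inject₁ (trans (sym σ̂c′≡top) σ̂c′≡σc′))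
    found (inj₂ ∄c) with insertMax-inject₁-cases σ (just c) c
    ... | inj₁ (_ , σ̂c≡top) = ⊥-elim (∄c c σ̂c≡top)
    ... | inj₂ (c≢c , _)    = ⊥-elim (c≢c refl)

  top-has-preimage : ∀ (σ : Fun (suc m)) → IsPerm σ → lookup σ top ≢ top →
    ¬ (∀ i → lookup σ (inject₁ i) ≢ top)
  top-has-preimage σ perm σtop≢top ∄i with pigeonhole (n<1+n m) (λ x → lower (lookup σ x))
  ... | i , j , i<j , lowerσi≡lowerσj = <-irrefl refl (subst (λ k → toℕ i < toℕ k) (sym i≡j) i<j)
    where
    σ≢top : ∀ x → lookup σ x ≢ top
    σ≢top x with view x
    ... | ‵fromℕ     = σtop≢top
    ... | ‵inject₁ k = ∄i k
    i≡j : i ≡ j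
    i≡j = perm i j (trans (sym (inject₁-lower _ (σ≢top i)))
                          (trans (cong inject₁ lowerσi≡lowerσj) (inject₁-lower _ (σ≢top j))))

  insertMax-removeMax : ∀ (σ : Fun (suc m)) → IsPerm σ → insertMax (removeMax σ) (topPredecessor σ) ≡ σ
  insertMax-removeMax σ perm with lookup σ top ≟F top
  ... | yes σtop≡top = lookup-extensionality _ _ λ x →
    trans (insertMax-lookup _ _ x) (at x (view x))
    where
    at : ∀ x → (v : View x) → image (removeMax σ) nothing v ≡ lookup σ x
    at _ ‵fromℕ       = sym σtop≡top
    at _ (‵inject₁ i) = trans (cong inject₁ (lookup-removeMax σ i))
                              (trans (cong (inject₁ ∘′ lower) (skipTop-≢ σi≢top)) (inject₁-lower _ σi≢top))
      where
      σi≢top : lookup σ (inject₁ i) ≢ top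
      σi≢top σi≡top = top≢inject₁ (perm _ _ (trans σtop≡top (sym σi≡top)))
  ... | no σtop≢top with findTop-cases σ
  ...   | inj₂ ∄i = ⊥-elim (top-has-preimage σ perm σtop≢top ∄i)
  ...   | inj₁ (c , found≡c , σc≡top) = lookup-extensionality _ _ λ x →
    trans (insertMax-lookup _ _ x)
          (trans (cong (λ o → image (removeMax σ) o (view x)) found≡c) (at x (view x)))
    where
    at : ∀ x → (v : View x) → image (removeMax σ) (just c) v ≡ lookup σ x
    at _ ‵fromℕ       =
      trans (cong inject₁ (lookup-removeMax σ c))
            (trans (cong (inject₁ ∘′ lower) (skipTop-top σc≡top)) (inject₁-lower _ σtop≢top))
    at _ (‵inject₁ i) = old (i ≟F c)
      where
      old : (d : Dec (i ≡ c)) → oldImage′ (removeMax σ) i c d ≡ lookup σ (inject₁ i)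
      old (yes refl) = sym σc≡top
      old (no i≢c)   =
        trans (cong inject₁ (lookup-removeMax σ i))
              (trans (cong (inject₁ ∘′ lower) (skipTop-≢ σi≢top)) (inject₁-lower _ σi≢top))
        where
        σi≢top : lookup σ (inject₁ i) ≢ top
        σi≢top σi≡top = i≢c (inject₁-injective (perm _ _ (trans σi≡top (sym σc≡top))))

indicator-× : {P Q : Set} (p : Dec P) (q : Dec Q) → indicator (p ×-dec q) ≡ indicator p * indicator q
indicator-× (yes _) (yes _) = refl
indicator-× (yes _) (no _)  = refl
indicator-× (no _)  _       = refl

indicator-sym : {A : Set} (_≟_ : DecidableEquality A) (x y : A) → indicator (x ≟ y) ≡ indicator (y ≟ x)
indicator-sym _≟_ x y = indicator-⇔ (mk⇔ sym sym) (x ≟ y) (y ≟ x)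

length-filter : {A : Set} {P : A → Set} (P? : Decidable P) (xs : List A) →
  length (filter P? xs) ≡ ∑ (λ x → indicator (P? x)) xs
length-filter P? []       = refl
length-filter P? (x ∷ xs) with does (P? x)
... | true  = cong suc (length-filter P? xs)
... | false = length-filter P? xs

Enumerates : {A : Set} → DecidableEquality A → List A → Set
Enumerates _≟_ xs = ∀ x → ∑ (λ y → indicator (y ≟ x)) xs ≡ 1

Enumerates-concatMap : {A B C : Set}
  (_≟A_ : DecidableEquality A) (_≟B_ : DecidableEquality B) (_≟C_ : DecidableEquality C)
  {xs : List A} {ys : List B} → Enumerates _≟A_ xs → Enumerates _≟B_ ys →
  (g : A → B → C) → (∀ {x y a b} → g x y ≡ g a b → x ≡ a × y ≡ b) →
  ∀ a b → ∑ (λ z → indicator (z ≟C g a b)) (concatMap (λ x → map (g x) ys) xs) ≡ 1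
Enumerates-concatMap _≟A_ _≟B_ _≟C_ {xs} {ys} enumA enumB g g-injective a b = begin
  ∑ (λ z → indicator (z ≟C g a b)) (concatMap (λ x → map (g x) ys) xs)
    ≡⟨ ∑-concatMap _ (λ x → map (g x) ys) xs ⟩
  ∑ (λ x → ∑ (λ z → indicator (z ≟C g a b)) (map (g x) ys)) xs
    ≡⟨ ∑-cong xs (λ x → ∑-map _ (g x) ys) ⟩
  ∑ (λ x → ∑ (λ y → indicator (g x y ≟C g a b)) ys) xs
    ≡⟨ ∑-cong xs (λ x → ∑-cong ys (λ y → split x y)) ⟩
  ∑ (λ x → ∑ (λ y → indicator (x ≟A a) * indicator (y ≟B b)) ys) xs
    ≡⟨ ∑-cong xs (λ x → ∑-*ˡ (indicator (x ≟A a)) _ ys) ⟩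
  ∑ (λ x → indicator (x ≟A a) * ∑ (λ y → indicator (y ≟B b)) ys) xs
    ≡⟨ ∑-cong xs (λ x → trans (cong (indicator (x ≟A a) *_) (enumB b)) (*-identityʳ _)) ⟩
  ∑ (λ x → indicator (x ≟A a)) xs
    ≡⟨ enumA a ⟩
  1 ∎
  where
  open ≡-Reasoning
  split : ∀ x y → indicator (g x y ≟C g a b) ≡ indicator (x ≟A a) * indicator (y ≟B b)
  split x y =
    trans (indicator-⇔ (mk⇔ g-injective λ { (refl , refl) → refl }) (g x y ≟C g a b) ((x ≟A a) ×-dec (y ≟B b)))
                    (indicator-× (x ≟A a) (y ≟B b))

Enumerates-allFin : ∀ n → Enumerates _≟F_ (List.allFin n)
Enumerates-allFin (suc n) i = begin
  ∑ (λ y → indicator (y ≟F i)) (fz ∷ List.tabulate fs)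
    ≡⟨ cong (λ ys → ∑ (λ y → indicator (y ≟F i)) (fz ∷ ys)) (Listₚ.map-tabulate (λ i → i) fs) ⟨
  indicator (fz ≟F i) + ∑ (λ y → indicator (y ≟F i)) (map fs (List.allFin n))
    ≡⟨ cong (indicator (fz ≟F i) +_) (∑-map _ fs (List.allFin n)) ⟩
  indicator (fz ≟F i) + ∑ (λ y → indicator (fs y ≟F i)) (List.allFin n)
    ≡⟨ at i ⟩
  1 ∎
  where
  open ≡-Reasoning
  at : ∀ i → indicator (fz ≟F i) + ∑ (λ y → indicator (fs y ≟F i)) (List.allFin n) ≡ 1
  at fz     = cong suc (∑-zero (List.allFin n) (λ _ → refl))
  at (fs i) = trans (∑-cong (List.allFin n) λ y →
                       indicator-⇔ (mk⇔ Finₚ.suc-injective (cong fs)) (fs y ≟F fs i) (y ≟F i))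
                    (Enumerates-allFin n i)

Enumerates-allVecs : {A : Set} (_≟_ : DecidableEquality A) {xs : List A} → Enumerates _≟_ xs →
  ∀ k → Enumerates (Vecₚ.≡-dec _≟_) (allVecs xs k)
Enumerates-allVecs _≟_ enum zero    []      = refl
Enumerates-allVecs _≟_ {xs} enum (suc k) (x ∷ v) =
  Enumerates-concatMap _≟_ (Vecₚ.≡-dec _≟_) (Vecₚ.≡-dec _≟_) {xs} {allVecs xs k}
    enum (Enumerates-allVecs _≟_ enum k) _∷_ Vecₚ.∷-injective x v

∑-indicator-bijection : {A B : Set} (_≟A_ : DecidableEquality A) (_≟B_ : DecidableEquality B)
  {xs : List A} {ys : List B} → Enumerates _≟A_ xs → Enumerates _≟B_ ys →
  {P : A → Set} {Q : B → Set} (P? : Decidable P) (Q? : Decidable Q) (f : A → B) (g : B → A) →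
  (∀ a → P a → Q (f a) × g (f a) ≡ a) → (∀ b → Q b → P (g b) × f (g b) ≡ b) →
  ∑ (λ x → indicator (P? x)) xs ≡ ∑ (λ y → indicator (Q? y)) ys
∑-indicator-bijection _≟A_ _≟B_ {xs} {ys} enumA enumB P? Q? f g gf≡ fg≡ = begin
  ∑ (λ x → indicator (P? x)) xs                   ≡⟨ ∑-cong xs (λ a → sym (column a)) ⟩
  ∑ (λ a → ∑ (λ b → hit a b) ys) xs        ≡⟨ ∑-comm hit xs ys ⟩
  ∑ (λ b → ∑ (λ a → hit a b) xs) ys        ≡⟨ ∑-cong ys row ⟩
  ∑ (λ y → indicator (Q? y)) ys                   ∎
  where
  open ≡-Reasoning
  hit : _ → _ → ℕ
  hit a b = indicator (Q? b) * indicator (g b ≟A a)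
  column : ∀ a → ∑ (hit a) ys ≡ indicator (P? a)
  column a with P? a
  ... | yes Pa = trans (∑-cong ys λ b → trans (sym (indicator-× (Q? b) (g b ≟A a)))
                         (indicator-⇔ (mk⇔ (λ { (Qb , refl) → sym (proj₂ (fg≡ b Qb)) }) (λ { refl → gf≡ a Pa }))
                                      (Q? b ×-dec (g b ≟A a)) (b ≟B f a)))
                       (enumB (f a))
  ... | no ¬Pa = ∑-zero ys λ b → trans (sym (indicator-× (Q? b) (g b ≟A a)))
                   (indicator-no (Q? b ×-dec (g b ≟A a)) (λ { (Qb , refl) → ¬Pa (proj₁ (fg≡ b Qb)) }))
  row : ∀ b → ∑ (λ a → hit a b) xs ≡ indicator (Q? b)
  row b = begin
    ∑ (λ a → hit a b) xs
      ≡⟨ ∑-*ˡ (indicator (Q? b)) _ xs ⟩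
    indicator (Q? b) * ∑ (λ a → indicator (g b ≟A a)) xs
      ≡⟨ cong (indicator (Q? b) *_) (trans (∑-cong xs (λ a → indicator-sym _≟A_ (g b) a)) (enumA (g b))) ⟩
    indicator (Q? b) * 1
      ≡⟨ *-identityʳ _ ⟩
    indicator (Q? b) ∎

∑-partition : {A K : Set} (_≟K_ : DecidableEquality K) {ks : List K} → Enumerates _≟K_ ks →
  (key : A → K) (f : A → ℕ) (xs : List A) →
  ∑ f xs ≡ ∑ (λ k → ∑ (λ x → f x * indicator (key x ≟K k)) xs) ks
∑-partition _≟K_ {ks} enum key f xs =
  trans (∑-cong xs (λ x → sym (trans (∑-*ˡ (f x) _ ks)
          (trans (cong (f x *_) (trans (∑-cong ks (λ k → indicator-sym _≟K_ (key x) k)) (enum (key x)))) (*-identityʳ _)))))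
        (∑-comm (λ x k → f x * indicator (key x ≟K k)) xs ks)

∏ : ∀ {r} → (Fin r → ℕ) → ℕ
∏ {zero}  f = 1
∏ {suc r} f = f fz * ∏ (λ p → f (fs p))

∑-allVecs-∏ : {A : Set} (xs : List A) (r : ℕ) (q : Fin r → A → ℕ) →
  ∑ (λ v → ∏ (λ p → q p (lookup v p))) (allVecs xs r) ≡ ∏ (λ p → ∑ (q p) xs)
∑-allVecs-∏ xs zero    q = refl
∑-allVecs-∏ xs (suc r) q = begin
  ∑ (λ v → ∏ (λ p → q p (lookup v p))) (concatMap (λ x → map (x ∷_) (allVecs xs r)) xs)
    ≡⟨ ∑-concatMap _ (λ x → map (x ∷_) (allVecs xs r)) xs ⟩
  ∑ (λ x → ∑ (λ v → ∏ (λ p → q p (lookup v p))) (map (x ∷_) (allVecs xs r))) xs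
    ≡⟨ ∑-cong xs (λ x → trans (∑-map _ (x ∷_) (allVecs xs r))
                        (trans (∑-*ˡ (q fz x) _ (allVecs xs r)) (cong (q fz x *_) (∑-allVecs-∏ xs r (λ p → q (fs p)))))) ⟩
  ∑ (λ x → q fz x * rest) xs
    ≡⟨ ∑-cong xs (λ x → *-comm (q fz x) rest) ⟩
  ∑ (λ x → rest * q fz x) xs
    ≡⟨ ∑-*ˡ rest (q fz) xs ⟩
  rest * ∑ (q fz) xs
    ≡⟨ *-comm rest _ ⟩
  ∑ (q fz) xs * rest ∎
  where
  open ≡-Reasoning
  rest = ∏ (λ p → ∑ (q (fs p)) xs)

-- Counting permutations by cycle minima and records

_≟Bs_ : ∀ {n} → DecidableEquality (Vec Bool n)
_≟Bs_ = Vecₚ.≡-dec _≟B_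

_≟Fun_ : ∀ {m} → DecidableEquality (Fun m)
_≟Fun_ = Vecₚ.≡-dec _≟F_

shift : (ℕ → ℕ) → ℕ → ℕ
shift q zero    = 0
shift q (suc b) = q b

∑-shift : {A : Set} (f : ℕ → A → ℕ) (xs : List A) (b : ℕ) →
  ∑ (λ x → shift (λ b′ → f b′ x) b) xs ≡ shift (λ b′ → ∑ (f b′) xs) b
∑-shift f xs zero    = ∑-zero xs (λ _ → refl)
∑-shift f xs (suc b) = refl

HasProfile : ∀ N → Vec Bool (suc N) → ℕ → Fun (suc N) → Set
HasProfile N M b σ = IsPerm σ × minima σ ≡ M × Sep N σ × rec σ ≡ suc b

hasProfile? : ∀ N M b (σ : Fun (suc N)) → Dec (HasProfile N M b σ)
hasProfile? N M b σ = isPerm? σ ×-dec (minima σ ≟Bs M) ×-dec sep? N σ ×-dec (rec σ ≟ suc b)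

isProfile : ∀ N → Vec Bool (suc N) → ℕ → Fun (suc N) → ℕ
isProfile N M b σ = indicator (hasProfile? N M b σ)

profileCount : ∀ N → Vec Bool (suc N) → ℕ → ℕ
profileCount N M b = ∑ (isProfile N M b) (allFuns (suc N))

rec-positive : ∀ {n} (σ : Fun (suc n)) → ∃ λ k → rec σ ≡ suc k
rec-positive {n} σ = first (lookup σ fz) refl
  where
  first : ∀ y → lookup σ fz ≡ y → ∃ λ k → rec σ ≡ suc k
  first fz     σ1≡y = 0 , cong recW (trans (orbitWord-walk σ) (cong (walkFrom σ n) σ1≡y))
  first (fs y) σ1≡y = _ , cong recW (trans (orbitWord-walk σ) (cong (walkFrom σ n) σ1≡y))

insertionPoints : ∀ m → List (Maybe (Fin m))
insertionPoints m = nothing ∷ map just (List.allFin m)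

Enumerates-insertionPoints : ∀ m → Enumerates (Maybeₚ.≡-dec _≟F_) (insertionPoints m)
Enumerates-insertionPoints m nothing  =
  cong suc (trans (∑-map _ just (List.allFin m)) (∑-zero (List.allFin m) (λ _ → refl)))
Enumerates-insertionPoints m (just c) = trans (∑-map _ just (List.allFin m))
  (trans (∑-cong (List.allFin m) λ y →
            indicator-⇔ (mk⇔ Maybeₚ.just-injective (cong just)) (Maybeₚ.≡-dec _≟F_ (just y) (just c)) (y ≟F c))
         (Enumerates-allFin m c))

Enumerates-allFuns : ∀ m → Enumerates _≟Fun_ (allFuns m)
Enumerates-allFuns m = Enumerates-allVecs _≟F_ {List.allFin m} (Enumerates-allFin m) m

Insertion : ℕ → Set
Insertion m = Fun m × Maybe (Fin m)

_≟I_ : ∀ {m} → DecidableEquality (Insertion m)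
_≟I_ = Productₚ.≡-dec _≟Fun_ (Maybeₚ.≡-dec _≟F_)

insertions : ∀ m → List (Insertion m)
insertions m = concatMap (λ σ → map (σ ,_) (insertionPoints m)) (allFuns m)

Enumerates-insertions : ∀ m → Enumerates _≟I_ (insertions m)
Enumerates-insertions m (σ , o) =
  Enumerates-concatMap _≟Fun_ (Maybeₚ.≡-dec _≟F_) _≟I_ {allFuns m} {insertionPoints m}
    (Enumerates-allFuns m) (Enumerates-insertionPoints m) _,_ (λ { refl → refl , refl }) σ o

InsertionProfile : ∀ N → Vec Bool (suc N) → Bool → ℕ → Insertion (suc N) → Set
InsertionProfile N M e b (σ , o) =
  IsPerm σ × minima σ ∷ʳ is-nothing o ≡ M ∷ʳ e × Sep N σ × rec σ + insertsAfter1 o ≡ suc b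

insertionProfile? : ∀ N M e b (x : Insertion (suc N)) → Dec (InsertionProfile N M e b x)
insertionProfile? N M e b (σ , o) =
  isPerm? σ ×-dec ((minima σ ∷ʳ is-nothing o) ≟Bs (M ∷ʳ e)) ×-dec sep? N σ ×-dec (rec σ + insertsAfter1 o ≟ suc b)

isInsertionProfile : ∀ N → Vec Bool (suc N) → Bool → ℕ → Insertion (suc N) → ℕ
isInsertionProfile N M e b x = indicator (insertionProfile? N M e b x)

module _ (k : ℕ) (M : Vec Bool (2 + k)) (e : Bool) where

  private
    N = suc k

  HasProfile-insertMax⁻ : ∀ b σ o →
    HasProfile (suc N) (M ∷ʳ e) b (insertMax σ o) → InsertionProfile N M e b (σ , o)
  HasProfile-insertMax⁻ b σ o (perm̂ , minimâ , sep̂ , reĉ) =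
    let perm = IsPerm-insertMax⁻ σ o perm̂ in
    perm , trans (sym (minima-insertMax σ o perm)) minimâ ,
    Sep-insertMax⁻ σ o perm sep̂ , trans (sym (rec-insertMax σ o perm)) reĉ

  HasProfile-insertMax⁺ : ∀ b σ o →
    InsertionProfile N M e b (σ , o) → HasProfile (suc N) (M ∷ʳ e) b (insertMax σ o)
  HasProfile-insertMax⁺ b σ o (perm , minima≡ , sep , rec≡) =
    IsPerm-insertMax⁺ σ o perm , trans (minima-insertMax σ o perm) minima≡ ,
    Sep-insertMax⁺ σ o perm sep , trans (rec-insertMax σ o perm) rec≡

  profileCount-insertions : ∀ b →
    profileCount (suc N) (M ∷ʳ e) b ≡ ∑ (isInsertionProfile N M e b) (insertions (suc N))
  profileCount-insertions b =
    ∑-indicator-bijection _≟Fun_ _≟I_ {allFuns (2 + N)} {insertions (suc N)}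
      (Enumerates-allFuns (2 + N)) (Enumerates-insertions (suc N))
      (hasProfile? (suc N) (M ∷ʳ e) b) (insertionProfile? N M e b)
      (λ σ → removeMax σ , topPredecessor σ) (λ (σ , o) → insertMax σ o) removed inserted
    where
    removed : ∀ σ → HasProfile (suc N) (M ∷ʳ e) b σ →
      InsertionProfile N M e b (removeMax σ , topPredecessor σ) × insertMax (removeMax σ) (topPredecessor σ) ≡ σ
    removed σ profile =
      HasProfile-insertMax⁻ b (removeMax σ) (topPredecessor σ) (subst (HasProfile (suc N) (M ∷ʳ e) b) (sym σ≡) profile) ,
      σ≡
      where
      σ≡ = insertMax-removeMax σ (proj₁ profile)
    inserted : ∀ x → InsertionProfile N M e b x →
      HasProfile (suc N) (M ∷ʳ e) b (insertMax (proj₁ x) (proj₂ x)) ×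
      (removeMax (insertMax (proj₁ x) (proj₂ x)) , topPredecessor (insertMax (proj₁ x) (proj₂ x))) ≡ x
    inserted (σ , o) profile =
      HasProfile-insertMax⁺ b σ o profile , cong₂ _,_ (removeMax-insertMax σ o) (topPredecessor-insertMax σ o)

  private
    [e≡_] : Bool → ℕ
    [e≡ e′ ] = indicator (e′ ≟B e)

  isInsertionProfile-split : ∀ b σ o b′ e′ → is-nothing o ≡ e′ →
    (rec σ + insertsAfter1 o ≡ suc b ⇔ rec σ ≡ suc b′) →
    isInsertionProfile N M e b (σ , o) ≡ [e≡ e′ ] * isProfile N M b′ σ
  isInsertionProfile-split b σ o b′ e′ refl rec⇔ =
    trans (indicator-⇔ profile⇔ (insertionProfile? N M e b (σ , o)) ((e′ ≟B e) ×-dec hasProfile? N M b′ σ))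
          (indicator-× (e′ ≟B e) (hasProfile? N M b′ σ))
    where
    open Equivalence rec⇔ using (to; from)
    profile⇔ : InsertionProfile N M e b (σ , o) ⇔ (e′ ≡ e × HasProfile N M b′ σ)
    profile⇔ = mk⇔
      (λ (perm , minima≡ , sep , rec≡) →
         Vecₚ.∷ʳ-injectiveʳ (minima σ) M minima≡ , perm , Vecₚ.∷ʳ-injectiveˡ (minima σ) M minima≡ , sep , to rec≡)
      (λ { (refl , perm , refl , sep , rec≡) → perm , refl , sep , from rec≡ })

  private
    +0⇔ : ∀ {a c} → (a + 0 ≡ c) ⇔ (a ≡ c)
    +0⇔ = mk⇔ (trans (sym (+-identityʳ _))) (trans (+-identityʳ _))

  isInsertionProfile-nothing : ∀ b σ → isInsertionProfile N M e b (σ , nothing) ≡ [e≡ true ] * isProfile N M b σ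
  isInsertionProfile-nothing b σ = isInsertionProfile-split b σ nothing b true refl +0⇔

  isInsertionProfile-after-fs : ∀ b σ c →
    isInsertionProfile N M e b (σ , just (fs c)) ≡ [e≡ false ] * isProfile N M b σ
  isInsertionProfile-after-fs b σ c = isInsertionProfile-split b σ (just (fs c)) b false refl +0⇔

  -- inserting top right after 1 makes it an additional record
  isInsertionProfile-after-1 : ∀ b σ →
    isInsertionProfile N M e b (σ , just fz) ≡ [e≡ false ] * shift (λ b′ → isProfile N M b′ σ) b
  isInsertionProfile-after-1 zero    σ =
    trans (indicator-no (insertionProfile? N M e 0 (σ , just fz)) λ (_ , _ , _ , rec≡) → one-more-record rec≡)
          (sym (*-zeroʳ [e≡ false ]))
    where
    one-more-record : rec σ + 1 ≢ 1
    one-more-record rec+1≡1 with rec-positive σ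
    ... | k′ , rec≡ = 1+n≢0 (trans (+-comm 1 k′) (suc-injective (trans (sym (cong (_+ 1) rec≡)) rec+1≡1)))
  isInsertionProfile-after-1 (suc b) σ = isInsertionProfile-split (suc b) σ (just fz) b false refl
    (mk⇔ (λ rec≡ → suc-injective (trans (+-comm 1 _) rec≡)) (λ rec≡ → trans (+-comm _ 1) (cong suc rec≡)))

  contribution : ℕ → Fun (suc N) → ℕ
  contribution b σ = [e≡ true ] * isProfile N M b σ +
                     ([e≡ false ] * shift (λ b′ → isProfile N M b′ σ) b + N * ([e≡ false ] * isProfile N M b σ))

  ∑-insertionPoints : ∀ b σ →
    ∑ (λ o → isInsertionProfile N M e b (σ , o)) (insertionPoints (suc N)) ≡ contribution b σ
  ∑-insertionPoints b σ = cong₂ _+_ (isInsertionProfile-nothing b σ) (begin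
    ∑ (λ o → at o) (map just (List.allFin (suc N)))
      ≡⟨ ∑-map at just (List.allFin (suc N)) ⟩
    ∑ (λ c → at (just c)) (fz ∷ List.tabulate fs)
      ≡⟨ cong (λ cs → ∑ (λ c → at (just c)) (fz ∷ cs)) (Listₚ.map-tabulate (λ i → i) fs) ⟨
    at (just fz) + ∑ (λ c → at (just c)) (map fs (List.allFin N))
      ≡⟨ cong₂ _+_ (isInsertionProfile-after-1 b σ) (∑-map (λ c → at (just c)) fs (List.allFin N)) ⟩
    after1 + ∑ (λ c → at (just (fs c))) (List.allFin N)
      ≡⟨ cong (after1 +_) (∑-cong (List.allFin N) (isInsertionProfile-after-fs b σ)) ⟩
    after1 + ∑ (λ _ → [e≡ false ] * isProfile N M b σ) (List.allFin N)
      ≡⟨ cong (after1 +_) (∑-const _ (List.allFin N)) ⟩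
    after1 + length (List.allFin N) * ([e≡ false ] * isProfile N M b σ)
      ≡⟨ cong (λ n → after1 + n * ([e≡ false ] * isProfile N M b σ)) (Listₚ.length-tabulate {n = N} (λ i → i)) ⟩
    after1 + N * ([e≡ false ] * isProfile N M b σ) ∎)
    where
    open ≡-Reasoning
    at : Maybe (Fin (suc N)) → ℕ
    at o = isInsertionProfile N M e b (σ , o)
    after1 = [e≡ false ] * shift (λ b′ → isProfile N M b′ σ) b

  profileCount-∷ʳ : ∀ b → profileCount (suc N) (M ∷ʳ e) b ≡ ∑ (contribution b) (allFuns (suc N))
  profileCount-∷ʳ b = begin
    profileCount (suc N) (M ∷ʳ e) b
      ≡⟨ profileCount-insertions b ⟩
    ∑ (isInsertionProfile N M e b) (concatMap (λ σ → map (σ ,_) (insertionPoints (suc N))) (allFuns (suc N)))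
      ≡⟨ ∑-concatMap (isInsertionProfile N M e b) (λ σ → map (σ ,_) (insertionPoints (suc N))) (allFuns (suc N)) ⟩
    ∑ (λ σ → ∑ (isInsertionProfile N M e b) (map (σ ,_) (insertionPoints (suc N)))) (allFuns (suc N))
      ≡⟨ ∑-cong (allFuns (suc N)) (λ σ → ∑-map (isInsertionProfile N M e b) (σ ,_) (insertionPoints (suc N))) ⟩
    ∑ (λ σ → ∑ (λ o → isInsertionProfile N M e b (σ , o)) (insertionPoints (suc N))) (allFuns (suc N))
      ≡⟨ ∑-cong (allFuns (suc N)) (∑-insertionPoints b) ⟩
    ∑ (contribution b) (allFuns (suc N)) ∎
    where open ≡-Reasoning

profileCount-new-cycle : ∀ k M b → profileCount (2 + k) (M ∷ʳ true) b ≡ profileCount (suc k) M b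
profileCount-new-cycle k M b =
  trans (profileCount-∷ʳ k M true b)
        (∑-cong (allFuns (2 + k)) λ σ →
           simplify (isProfile (suc k) M b σ) (shift (λ b′ → isProfile (suc k) M b′ σ) b) k)
  where
  simplify : ∀ x y k → 1 * x + (0 * y + suc k * (0 * x)) ≡ x
  simplify = solve-∀

profileCount-old-cycle : ∀ k M b →
  profileCount (2 + k) (M ∷ʳ false) b ≡ suc k * profileCount (suc k) M b + shift (profileCount (suc k) M) b
profileCount-old-cycle k M b = begin
  profileCount (2 + k) (M ∷ʳ false) b
    ≡⟨ profileCount-∷ʳ k M false b ⟩
  ∑ (λ σ → 0 * isProfile (suc k) M b σ + (1 * previous σ + suc k * (1 * isProfile (suc k) M b σ))) (allFuns (2 + k))
    ≡⟨ ∑-cong (allFuns (2 + k)) (λ σ → simplify (isProfile (suc k) M b σ) (previous σ) k) ⟩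
  ∑ (λ σ → previous σ + suc k * isProfile (suc k) M b σ) (allFuns (2 + k))
    ≡⟨ ∑-+ previous _ (allFuns (2 + k)) ⟩
  ∑ previous (allFuns (2 + k)) + ∑ (λ σ → suc k * isProfile (suc k) M b σ) (allFuns (2 + k))
    ≡⟨ cong₂ _+_ (∑-shift (isProfile (suc k) M) (allFuns (2 + k)) b)
                 (∑-*ˡ (suc k) (isProfile (suc k) M b) (allFuns (2 + k))) ⟩
  shift (profileCount (suc k) M) b + suc k * profileCount (suc k) M b
    ≡⟨ +-comm (shift (profileCount (suc k) M) b) _ ⟩
  suc k * profileCount (suc k) M b + shift (profileCount (suc k) M) b ∎
  where
  open ≡-Reasoning
  previous : Fun (2 + k) → ℕ
  previous σ = shift (λ b′ → isProfile (suc k) M b′ σ) b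
  simplify : ∀ x y k → 0 * x + (1 * y + suc k * (1 * x)) ≡ y + suc k * x
  simplify = solve-∀

-- Grouping tuples by their common cycle minima

trues : ∀ {m} → Vec Bool m → ℕ
trues []      = 0
trues (x ∷ v) = (if x then 1 else 0) + trues v

trues-∷ʳ : ∀ {m} (v : Vec Bool m) x → trues (v ∷ʳ x) ≡ trues v + (if x then 1 else 0)
trues-∷ʳ []      x = +-identityʳ _
trues-∷ʳ (y ∷ v) x =
  trans (cong ((if y then 1 else 0) +_) (trues-∷ʳ v x)) (sym (+-assoc (if y then 1 else 0) (trues v) _))

length-filter-tabulate : {A : Set} {P : A → Set} (P? : Decidable P) {m : ℕ} (f : Fin m → A) →
  length (filter P? (List.tabulate f)) ≡ trues (Vec.tabulate (λ i → does (P? (f i))))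
length-filter-tabulate P? {zero}  f = refl
length-filter-tabulate P? {suc m} f with does (P? (f fz))
... | true  = cong suc (length-filter-tabulate P? (λ i → f (fs i)))
... | false = length-filter-tabulate P? (λ i → f (fs i))

cycles-minima : ∀ {m} (σ : Fun m) → cycles σ ≡ trues (minima σ)
cycles-minima σ = length-filter-tabulate (isCycleMin? σ) (λ i → i)

minima-cong : ∀ {m} (τ τ′ : Fun m) →
  (∀ i → IsCycleMin τ i → IsCycleMin τ′ i) → (∀ i → IsCycleMin τ′ i → IsCycleMin τ i) →
  minima τ ≡ minima τ′
minima-cong τ τ′ to from =
  Vecₚ.tabulate-cong (λ i → does-⇔ (mk⇔ (to i) (from i)) (isCycleMin? τ i) (isCycleMin? τ′ i))

minima-≡⇒IsCycleMin : ∀ {m} (τ τ′ : Fun m) → minima τ ≡ minima τ′ → ∀ i → IsCycleMin τ i → IsCycleMin τ′ i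
minima-≡⇒IsCycleMin τ τ′ minima≡ i min = decidable-stable (isCycleMin? τ′ i) λ ¬min′ →
  case trans (sym (dec-true (isCycleMin? τ i) min))
             (trans (sym (lookup-minima τ i)) (trans (cong (λ v → lookup v i) minima≡)
                    (trans (lookup-minima τ′ i) (dec-false (isCycleMin? τ′ i) ¬min′)))) of λ ()

productPoly : ∀ {r} → (ℕ → ℕ) → Poly r
productPoly q []      = 1
productPoly q (b ∷ β) = q b * productPoly q β

∏-lookup : ∀ {r} (q : ℕ → ℕ) (β : Vec ℕ r) → ∏ (λ p → q (lookup β p)) ≡ productPoly q β
∏-lookup q []      = refl
∏-lookup q (b ∷ β) = cong (q b *_) (∏-lookup q β)

indicator-all? : ∀ {r} {P : Fin r → Set} (P? : ∀ p → Dec (P p)) →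
  indicator (all? P?) ≡ ∏ (λ p → indicator (P? p))
indicator-all? {zero}  P? = indicator-yes (all? P?) (λ ())
indicator-all? {suc r} P? = begin
  indicator (all? P?)
    ≡⟨ indicator-⇔ all⇔ (all? P?) (P? fz ×-dec all? (λ p → P? (fs p))) ⟩
  indicator (P? fz ×-dec all? (λ p → P? (fs p)))
    ≡⟨ indicator-× (P? fz) (all? (λ p → P? (fs p))) ⟩
  indicator (P? fz) * indicator (all? (λ p → P? (fs p)))
    ≡⟨ cong (indicator (P? fz) *_) (indicator-all? (λ p → P? (fs p))) ⟩
  indicator (P? fz) * ∏ (λ p → indicator (P? (fs p))) ∎
  where
  open ≡-Reasoning
  all⇔ : (∀ p → _) ⇔ (_ × (∀ p → _))
  all⇔ = mk⇔ (λ all → all fz , (λ p → all (fs p))) (λ { (P0 , _) fz → P0 ; (_ , Ps) (fs p) → Ps p })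

bools : List Bool
bools = true ∷ false ∷ []

Enumerates-bools : Enumerates _≟B_ bools
Enumerates-bools true  = refl
Enumerates-bools false = refl

-- A tuple counted with common cycle minima M (as an indicator vector) has trues M = j + 1,
-- and its components are then chosen independently.
countByMinima : ∀ {r} → ℕ → ℕ → Poly r
countByMinima j n β =
  ∑ (λ M → indicator (trues M ≟ suc j) * productPoly (profileCount n M) β) (allVecs bools (suc n))

module _ (r′ n j : ℕ) (β : Vec ℕ (suc r′)) where

  private
    Tuple = Vec (Fun (suc n)) (suc r′)

    AllHaveProfile : Vec Bool (suc n) → Tuple → Set
    AllHaveProfile M π = ∀ p → HasProfile n M (lookup β p) (lookup π p)

    allHaveProfile? : ∀ M π → Dec (AllHaveProfile M π)
    allHaveProfile? M π = all? (λ p → hasProfile? n M (lookup β p) (lookup π p))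

  Counted⇔ : ∀ M π →
    (Counted n j β π × minima (lookup π fz) ≡ M) ⇔ (trues M ≡ suc j × AllHaveProfile M π)
  Counted⇔ M π = mk⇔ to from
    where
    to : Counted n j β π × minima (lookup π fz) ≡ M → trues M ≡ suc j × AllHaveProfile M π
    to (((perm , cyc , mins , sep) , recs) , minima₁≡M) =
      trans (cong trues (sym minima₁≡M)) (trans (sym (cycles-minima (lookup π fz))) (cyc fz)) ,
      λ p → perm p , trans (minima-cong (lookup π p) (lookup π fz) (mins p fz) (mins fz p)) minima₁≡M , sep p , recs p
    from : trues M ≡ suc j × AllHaveProfile M π → Counted n j β π × minima (lookup π fz) ≡ M
    from (trues≡ , profiles) = ((perm , cyc , mins , sep) , recs) , proj₁ (proj₂ (profiles fz))
      where
      perm = λ p → proj₁ (profiles p)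
      minimaₚ = λ p → proj₁ (proj₂ (profiles p))
      cyc = λ p → trans (cycles-minima (lookup π p)) (trans (cong trues (minimaₚ p)) trues≡)
      sep = λ p → proj₁ (proj₂ (proj₂ (profiles p)))
      recs = λ p → proj₂ (proj₂ (proj₂ (profiles p)))
      mins : ∀ p q i → IsCycleMin (lookup π p) i → IsCycleMin (lookup π q) i
      mins p q = minima-≡⇒IsCycleMin (lookup π p) (lookup π q) (trans (minimaₚ p) (sym (minimaₚ q)))

  -- grouping by the minima of the first component, which exists because r ≥ 1
  countTuples-byMinima : countTuples (suc r′) n j β ≡ countByMinima j n β
  countTuples-byMinima = begin
    countTuples (suc r′) n j β
      ≡⟨ length-filter (counted? n j β) (allVecs (allFuns (suc n)) (suc r′)) ⟩
    ∑ (λ π → indicator (counted? n j β π)) tuples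
      ≡⟨ ∑-partition _≟Bs_ {minimaPatterns} (Enumerates-allVecs _≟B_ Enumerates-bools (suc n))
                     (λ π → minima (lookup π fz)) (λ π → indicator (counted? n j β π)) tuples ⟩
    ∑ (λ M → ∑ (λ π → indicator (counted? n j β π) * indicator (minima (lookup π fz) ≟Bs M)) tuples) minimaPatterns
      ≡⟨ ∑-cong minimaPatterns (λ M → ∑-cong tuples (term M)) ⟩
    ∑ (λ M → ∑ (λ π → indicator (trues M ≟ suc j) * ∏ (λ p → isProfile n M (lookup β p) (lookup π p))) tuples) minimaPatterns
      ≡⟨ ∑-cong minimaPatterns (λ M → trans (∑-*ˡ (indicator (trues M ≟ suc j)) _ tuples)
                                             (cong (indicator (trues M ≟ suc j) *_) (factor M))) ⟩
    countByMinima j n β ∎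
    where
    open ≡-Reasoning
    tuples = allVecs (allFuns (suc n)) (suc r′)
    minimaPatterns = allVecs bools (suc n)
    term : ∀ M π → indicator (counted? n j β π) * indicator (minima (lookup π fz) ≟Bs M) ≡
                   indicator (trues M ≟ suc j) * ∏ (λ p → isProfile n M (lookup β p) (lookup π p))
    term M π = begin
      indicator (counted? n j β π) * indicator (minima (lookup π fz) ≟Bs M)
        ≡⟨ indicator-× (counted? n j β π) (minima (lookup π fz) ≟Bs M) ⟨
      indicator (counted? n j β π ×-dec (minima (lookup π fz) ≟Bs M))
        ≡⟨ indicator-⇔ (Counted⇔ M π) (counted? n j β π ×-dec (minima (lookup π fz) ≟Bs M))
                                      ((trues M ≟ suc j) ×-dec allHaveProfile? M π) ⟩
      indicator ((trues M ≟ suc j) ×-dec allHaveProfile? M π)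
        ≡⟨ indicator-× (trues M ≟ suc j) (allHaveProfile? M π) ⟩
      indicator (trues M ≟ suc j) * indicator (allHaveProfile? M π)
        ≡⟨ cong (indicator (trues M ≟ suc j) *_) (indicator-all? (λ p → hasProfile? n M (lookup β p) (lookup π p))) ⟩
      indicator (trues M ≟ suc j) * ∏ (λ p → isProfile n M (lookup β p) (lookup π p)) ∎
    factor : ∀ M →
      ∑ (λ π → ∏ (λ p → isProfile n M (lookup β p) (lookup π p))) tuples ≡ productPoly (profileCount n M) β
    factor M = trans (∑-allVecs-∏ (allFuns (suc n)) (suc r′) (λ p → isProfile n M (lookup β p)))
                     (∏-lookup (profileCount n M) β)

-- The recurrence for countByMinima

mulF-productPoly : ∀ {r} x (q : ℕ → ℕ) →
  mulF {r} x (productPoly q) ≈ productPoly (λ b → x * q b + shift q b)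
mulF-productPoly x q []          = refl
mulF-productPoly x q (zero ∷ β)  =
  trans (cong (x *_) (trans (mulF-* x (q 0) (productPoly q) β) (cong (q 0 *_) (mulF-productPoly x q β))))
        (regroup x (q 0) _)
  where
  regroup : ∀ x a c → x * (a * c) ≡ (x * a + 0) * c
  regroup = solve-∀
mulF-productPoly x q (suc b ∷ β) =
  trans (cong₂ _+_ (cong (x *_) (trans (mulF-* x (q (suc b)) (productPoly q) β)
                                      (cong (q (suc b) *_) (mulF-productPoly x q β))))
                   (trans (mulF-* x (q b) (productPoly q) β) (cong (q b *_) (mulF-productPoly x q β))))
        (regroup x (q (suc b)) (q b) _)
  where
  regroup : ∀ x a a′ c → x * (a * c) + a′ * c ≡ (x * a + a′) * c
  regroup = solve-∀

mulF-∑ : ∀ {r} {K : Set} x (c : K → ℕ) (P : K → Poly r) (ks : List K) →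
  mulF x (λ β → ∑ (λ k → c k * P k β) ks) ≈ (λ β → ∑ (λ k → c k * mulF x (P k) β) ks)
mulF-∑ x c P []       β = mulF-zero x β
mulF-∑ x c P (k ∷ ks) β =
  trans (mulF-⊕ x (λ β → c k * P k β) (λ β → ∑ (λ k → c k * P k β) ks) β)
        (cong₂ _+_ (mulF-* x (c k) (P k) β) (mulF-∑ x c P ks β))

productPoly-cong : ∀ {r} {q q′ : ℕ → ℕ} → (∀ b → q b ≡ q′ b) → productPoly {r} q ≈ productPoly q′
productPoly-cong q≗q′ []      = refl
productPoly-cong q≗q′ (b ∷ β) = cong₂ _*_ (q≗q′ b) (productPoly-cong q≗q′ β)

productPoly-zero : ∀ {r} {q : ℕ → ℕ} → (∀ b → q b ≡ 0) → productPoly {suc r} q ≈ zeroP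
productPoly-zero {q = q} q≗0 (b ∷ β) = cong (_* productPoly q β) (q≗0 b)

∑-allVecs-∷ʳ : {A : Set} (xs : List A) (m : ℕ) (F : Vec A (suc m) → ℕ) →
  ∑ F (allVecs xs (suc m)) ≡ ∑ (λ v → ∑ (λ x → F (v ∷ʳ x)) xs) (allVecs xs m)
∑-allVecs-∷ʳ xs zero    F =
  trans (∑-concatMap F (λ x → map (x ∷_) (allVecs xs 0)) xs)
        (trans (∑-cong xs (λ x → +-identityʳ _)) (sym (+-identityʳ _)))
∑-allVecs-∷ʳ xs (suc m) F = begin
  ∑ F (concatMap (λ x → map (x ∷_) (allVecs xs (suc m))) xs)
    ≡⟨ ∑-concatMap F (λ x → map (x ∷_) (allVecs xs (suc m))) xs ⟩
  ∑ (λ x → ∑ F (map (x ∷_) (allVecs xs (suc m)))) xs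
    ≡⟨ ∑-cong xs (λ x → trans (∑-map F (x ∷_) (allVecs xs (suc m))) (∑-allVecs-∷ʳ xs m (λ v → F (x ∷ v)))) ⟩
  ∑ (λ x → ∑ (λ v → G (x ∷ v)) (allVecs xs m)) xs
    ≡⟨ ∑-cong xs (λ x → ∑-map G (x ∷_) (allVecs xs m)) ⟨
  ∑ (λ x → ∑ G (map (x ∷_) (allVecs xs m))) xs
    ≡⟨ ∑-concatMap G (λ x → map (x ∷_) (allVecs xs m)) xs ⟨
  ∑ G (concatMap (λ x → map (x ∷_) (allVecs xs m)) xs) ∎
  where
  open ≡-Reasoning
  G : Vec _ (suc m) → ℕ
  G v = ∑ (λ y → F (v ∷ʳ y)) xs

-- 1 is a cycle minimum of every permutation
profileCount-1-not-minimum : ∀ N (v : Vec Bool N) b → profileCount N (false ∷ v) b ≡ 0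
profileCount-1-not-minimum N v b = ∑-zero (allFuns (suc N)) λ σ →
  indicator-no (hasProfile? N (false ∷ v) b σ) λ (_ , minima≡ , _) →
    case trans (sym (dec-true (isCycleMin? σ fz) (λ _ _ → z≤n)))
               (trans (sym (lookup-minima σ fz)) (cong (λ w → lookup w fz) minima≡)) of λ ()

module _ (r′ k j : ℕ) (β : Vec ℕ (suc r′)) where

  private
    N = suc k

    newCycle oldCycle : Vec Bool (suc N) → ℕ
    newCycle M = indicator (trues M + 1 ≟ suc j) * productPoly (profileCount N M) β
    oldCycle M = indicator (trues M ≟ suc j) * mulF N (productPoly (profileCount N M)) β

    term : Vec Bool (2 + N) → ℕ
    term M = indicator (trues M ≟ suc j) * productPoly (profileCount (suc N) M) β

    term-new : ∀ M → term (M ∷ʳ true) ≡ newCycle M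
    term-new M = cong₂ _*_
      (indicator-⇔ (mk⇔ (trans (sym (trues-∷ʳ M true))) (trans (trues-∷ʳ M true)))
                   (trues (M ∷ʳ true) ≟ suc j) (trues M + 1 ≟ suc j))
      (productPoly-cong (profileCount-new-cycle k M) β)

    term-old : ∀ M → term (M ∷ʳ false) ≡ oldCycle M
    term-old M = cong₂ _*_
      (indicator-⇔ (mk⇔ (trans (sym (trues≡))) (trans trues≡)) (trues (M ∷ʳ false) ≟ suc j) (trues M ≟ suc j))
      (trans (productPoly-cong (profileCount-old-cycle k M) β) (sym (mulF-productPoly N (profileCount N M) β)))
      where
      trues≡ : trues (M ∷ʳ false) ≡ trues M
      trues≡ = trans (trues-∷ʳ M false) (+-identityʳ _)

    ∑-newCycle : ∀ j →
      ∑ (λ M → indicator (trues M + 1 ≟ suc j) * productPoly (profileCount N M) β) (allVecs bools (suc N)) ≡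
      prevJ countByMinima j N β
    ∑-newCycle zero    = ∑-zero (allVecs bools (suc N)) no-new-cycle
      where
      no-new-cycle : ∀ M → indicator (trues M + 1 ≟ 1) * productPoly (profileCount N M) β ≡ 0
      no-new-cycle (true ∷ v)  = cong (_* productPoly (profileCount N (true ∷ v)) β)
        (indicator-no (trues (true ∷ v) + 1 ≟ 1) λ eq →
           1+n≢0 (suc-injective (trans (cong suc (+-comm 1 (trues v))) (trans (sym (+-assoc 1 (trues v) 1)) eq))))
      no-new-cycle (false ∷ v) =
        trans (cong (indicator (trues (false ∷ v) + 1 ≟ 1) *_) (productPoly-zero (profileCount-1-not-minimum N v) β))
                                       (*-zeroʳ (indicator (trues (false ∷ v) + 1 ≟ 1)))
    ∑-newCycle (suc j) = ∑-cong (allVecs bools (suc N)) λ M →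
      cong (_* productPoly (profileCount N M) β)
           (indicator-⇔ (mk⇔ (λ eq → suc-injective (trans (+-comm 1 _) eq)) (λ eq → trans (+-comm _ 1) (cong suc eq)))
                        (trues M + 1 ≟ 2 + j) (trues M ≟ suc j))

  countByMinima-step : countByMinima j (suc N) β ≡ prevJ countByMinima j N β + mulF N (countByMinima j N) β
  countByMinima-step = begin
    ∑ term (allVecs bools (2 + N))
      ≡⟨ ∑-allVecs-∷ʳ bools (suc N) term ⟩
    ∑ (λ M → term (M ∷ʳ true) + (term (M ∷ʳ false) + 0)) patterns
      ≡⟨ ∑-cong patterns (λ M → cong₂ _+_ (term-new M) (trans (+-identityʳ _) (term-old M))) ⟩
    ∑ (λ M → newCycle M + oldCycle M) patterns
      ≡⟨ ∑-+ newCycle oldCycle patterns ⟩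
    ∑ newCycle patterns + ∑ oldCycle patterns
      ≡⟨ cong₂ _+_ (∑-newCycle j)
                   (sym (mulF-∑ N (λ M → indicator (trues M ≟ suc j)) (λ M → productPoly (profileCount N M)) patterns β)) ⟩
    prevJ countByMinima j N β + mulF N (countByMinima j N) β ∎
    where
    open ≡-Reasoning
    patterns = allVecs bools (suc N)

-- The cases n = 0, 1, which the recurrence does not reach

δ₀ : ℕ → ℕ
δ₀ zero    = 1
δ₀ (suc _) = 0

productPoly-δ₀ : ∀ {r} → productPoly {r} δ₀ ≈ const 1
productPoly-δ₀ []          = refl
productPoly-δ₀ (zero ∷ β)  = trans (+-identityʳ _) (productPoly-δ₀ β)
productPoly-δ₀ (suc b ∷ β) = refl

profileCount-0 : ∀ b → profileCount 0 (true ∷ []) b ≡ δ₀ b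
profileCount-0 zero    = refl
profileCount-0 (suc b) = refl

profileCount-1 : ∀ b → profileCount 1 (true ∷ true ∷ []) b ≡ δ₀ b
profileCount-1 zero    = refl
profileCount-1 (suc b) = refl

profileCount-1-two-cycles : ∀ M b → M ≢ true ∷ true ∷ [] → profileCount 1 M b ≡ 0
profileCount-1-two-cycles (true  ∷ true  ∷ []) b M≢ = ⊥-elim (M≢ refl)
profileCount-1-two-cycles (true  ∷ false ∷ []) zero    _ = refl
profileCount-1-two-cycles (true  ∷ false ∷ []) (suc b) _ = refl
profileCount-1-two-cycles (false ∷ v)          b _ = profileCount-1-not-minimum 1 v b

Ef≈countByMinima-0 : ∀ r′ j → Ef (suc r′) j 0 ≈ countByMinima j 0
Ef≈countByMinima-0 r′ zero    β =
  sym (trans (+-identityʳ _) (trans (+-identityʳ _) (trans (productPoly-cong profileCount-0 β) (productPoly-δ₀ β))))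
Ef≈countByMinima-0 r′ (suc j) β = refl

Ef≈countByMinima-1 : ∀ r′ j → Ef (suc r′) j 1 ≈ countByMinima j 1
Ef≈countByMinima-1 r′ j β = sym (begin
  countByMinima j 1 β
    ≡⟨ cong (term (true ∷ true ∷ []) +_) (cong₂ _+_ (vanish (true ∷ false ∷ []) (λ ()))
        (cong₂ _+_ (vanish (false ∷ true ∷ []) (λ ())) (cong (_+ 0) (vanish (false ∷ false ∷ []) (λ ()))))) ⟩
  term (true ∷ true ∷ []) + 0
    ≡⟨ +-identityʳ _ ⟩
  term (true ∷ true ∷ [])
    ≡⟨ at j ⟩
  Ef (suc r′) j 1 β ∎)
  where
  open ≡-Reasoning
  term : Vec Bool 2 → ℕ
  term M = indicator (trues M ≟ suc j) * productPoly (profileCount 1 M) β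
  vanish : ∀ M → M ≢ true ∷ true ∷ [] → term M ≡ 0
  vanish M M≢ = trans (cong (indicator (trues M ≟ suc j) *_) (productPoly-zero (λ b → profileCount-1-two-cycles M b M≢) β))
                      (*-zeroʳ (indicator (trues M ≟ suc j)))
  at : ∀ j → indicator (trues (true ∷ true ∷ []) ≟ suc j) * productPoly (profileCount 1 (true ∷ true ∷ [])) β ≡
             Ef (suc r′) j 1 β
  at zero          = refl
  at (suc zero)    = trans (+-identityʳ _) (trans (productPoly-cong profileCount-1 β) (productPoly-δ₀ β))
  at (suc (suc j)) = refl

Ef≈countByMinima : ∀ r′ n j → Ef (suc r′) j n ≈ countByMinima j n
Ef≈countByMinima r′ zero          j   = Ef≈countByMinima-0 r′ j
Ef≈countByMinima r′ (suc zero)    j   = Ef≈countByMinima-1 r′ j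
Ef≈countByMinima r′ (suc (suc k)) j β = begin
  Ef (suc r′) j (2 + k) β
    ≡⟨ Ef-step (suc r′) k j β ⟩
  prevJ (Ef (suc r′)) j (suc k) β + mulF (suc k) (Ef (suc r′) j (suc k)) β
    ≡⟨ cong₂ _+_ (prev j) (mulF-cong (suc k) (Ef≈countByMinima r′ (suc k) j) β) ⟩
  prevJ countByMinima j (suc k) β + mulF (suc k) (countByMinima j (suc k)) β
    ≡⟨ countByMinima-step r′ k j β ⟨
  countByMinima j (2 + k) β ∎
  where
  open ≡-Reasoning
  prev : ∀ j → prevJ (Ef (suc r′)) j (suc k) β ≡ prevJ countByMinima j (suc k) β
  prev zero    = refl
  prev (suc j) = Ef≈countByMinima r′ (suc k) j β

propositionP : (r : ℕ) → 1 ≤ r → (n j : ℕ) → (β : Vec ℕ r) →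
    Ef r j n β ≡ countTuples r n j β
propositionP (suc r′) _ n j β = trans (Ef≈countByMinima r′ n j β) (sym (countTuples-byMinima r′ n j β))
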